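{- Let $1\le j\le n$ and let $F=\{x_1,\dots,x_j\}$ be a partition of $[n]$ into $j$ blocks all of size at least $2$. Choose elements $s_i\in x_i$ and set $x_i^{1}=x_i$, $x_i^{ -1}=\{s_i\}$. Let $HO(F)=\{\{x_1^{\epsilon_1},\dots,x_j^{\epsilon_j}\} : (\epsilon_1,\dots,\epsilon_j)\in\{ -1,1\}^j\}$, and let $\sigma_F$ be the $(j-1)$-chain of $D_n$ given by the sum of the faces in $HO(F)$ (with coherent orientations). Then each $\sigma_F$ is a $(j-1)$-cycle which is (combinatorially) the boundary of a $j$-dimensional cross-polytope, and the classes $[\sigma_F]$, as $F$ ranges over all partitions of $[n]$ into exactly $j$ blocks with no singleton block, form a basis of $\widetilde{H}_{j-1}(D_n)$.
   Context: $[n]=\{1,\dots,n\}$. A partial partition of $[n]$ is a set of pairwise disjoint nonempty subsets (blocks) of $[n]$. $D_n$ is the abstract simplicial complex whose vertices are the nonempty subsets of $[n]$ and whose faces are the partial partitions of $[n]$. $\widetilde{H}_\ast$ denotes reduced simplicial homology with integer coefficients. A singleton block is a block of size $1$. -}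

module Defs where

open import Data.Nat using (ℕ; zero; suc; _≤_)
open import Data.Bool using (Bool; true; false; if_then_else_; T)
open import Data.Fin using (Fin)
open import Data.Fin.Subset using (Subset; _∈_; ⁅_⁆; ∣_∣; Nonempty; Empty; _∩_)
open import Data.Integer using (ℤ; +_; -_; _*_; _+_)
open import Data.List using (List; []; _∷_; map; concatMap; length; _++_)
open import Data.List.Relation.Unary.All using (All)
open import Data.List.Relation.Unary.Any using (Any)
open import Data.List.Relation.Unary.AllPairs using (AllPairs)
open import Data.List.Relation.Unary.Linked using (Linked)
import Data.List.Properties as LP
import Data.Vec.Properties as VP
open import Data.Vec using (Vec; lookup; tabulate; toList)
open import Data.Product using (Σ; _×_; _,_; proj₁; proj₂)
open import Relation.Binary.PropositionalEquality using (_≡_; _≢_)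
open import Relation.Nullary using (yes; no)
import Data.Bool.Properties as BP

-- Vertices of D_n : nonempty subsets of [n] = Fin n, as Subset n.
-- A strict total (lexicographic) order on Subset n, used only to pick a
-- canonical ordering of each face (for orientations / chain equality).

ltS : ∀ {n} → Subset n → Subset n → Bool
ltS Vec.[] Vec.[] = false
ltS (false Vec.∷ p) (true Vec.∷ q) = true
ltS (true Vec.∷ p) (false Vec.∷ q) = false
ltS (false Vec.∷ p) (false Vec.∷ q) = ltS p q
ltS (true Vec.∷ p) (true Vec.∷ q) = ltS p q

insertS : ∀ {n} → Subset n → List (Subset n) → ℤ × List (Subset n)
insertS x [] = (+ 1 , x ∷ [])
insertS x (y ∷ ys) with ltS y x
... | true  = let r = insertS x ys in (- proj₁ r , y ∷ proj₂ r)
... | false = (+ 1 , x ∷ y ∷ ys)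

sortS : ∀ {n} → List (Subset n) → ℤ × List (Subset n)
sortS [] = (+ 1 , [])
sortS (x ∷ xs) =
  let r = sortS xs
      t = insertS x (proj₂ r)
  in (proj₁ r * proj₁ t , proj₂ t)

-- Faces of D_n: partial partitions, written as ordered lists of blocks.
-- A face with k vertices has dimension k - 1; the empty list is the empty
-- face (dimension -1), which yields the augmented (reduced) complex.

Disjoint : ∀ {n} → Subset n → Subset n → Set
Disjoint p q = Empty (p ∩ q)

IsFace : ∀ {n} → List (Subset n) → Set
IsFace v = All Nonempty v × AllPairs Disjoint v

-- Integral chains: finite formal sums of oriented (ordered) simplices.
Chain : ℕ → Set
Chain n = List (ℤ × List (Subset n))

IsChainOf : ∀ {n} → ℕ → Chain n → Set
IsChainOf k c = All (λ t → length (proj₂ t) ≡ k × IsFace (proj₂ t)) c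

-- coefficient of a chain at the (canonically sorted) simplex τ, taking into
-- account the orientation sign: an ordered simplex equals sign(π) times
-- its sorted version.
coeff : ∀ {n} → Chain n → List (Subset n) → ℤ
coeff [] τ = + 0
coeff ((a , v) ∷ c) τ with LP.≡-dec (VP.≡-dec BP._≟_) (proj₂ (sortS v)) τ
... | yes _ = proj₁ (sortS v) * a + coeff c τ
... | no _  = coeff c τ

_≈_ : ∀ {n} → Chain n → Chain n → Set
c ≈ d = ∀ τ → coeff c τ ≡ coeff d τ

-- simplicial boundary (augmented: ∂ of a vertex is the empty face)
∂term : ∀ {n} → ℤ → List (Subset n) → Chain n
∂term a [] = []
∂term a (x ∷ xs) = (a , xs) ∷ map (λ t → (proj₁ t , x ∷ proj₂ t)) (∂term (- a) xs)

∂ : ∀ {n} → Chain n → Chain n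
∂ = concatMap (λ t → ∂term (proj₁ t) (proj₂ t))

scale : ∀ {n} → ℤ → Chain n → Chain n
scale a = map (λ t → (a * proj₁ t , proj₂ t))

-- Partitions of [n] into j blocks, all of size ≥ 2 (no singleton block),
-- represented uniquely with blocks in strictly increasing order.

record NSPart (n j : ℕ) : Set where
  field
    blocks   : Vec (Subset n) j
    sorted   : Linked (λ p q → T (ltS p q)) (toList blocks)
    disjoint : AllPairs Disjoint (toList blocks)
    covers   : ∀ (a : Fin n) → Any (a ∈_) (toList blocks)
    big      : ∀ (i : Fin j) → 2 ≤ ∣ lookup blocks i ∣
open NSPart public

-- all sign vectors ε ∈ {-1,1}^j  (true = +1, false = -1)
allSigns : (j : ℕ) → List (Vec Bool j)
allSigns zero = Vec.[] ∷ []
allSigns (suc j) = map (true Vec.∷_) (allSigns j) ++ map (false Vec.∷_) (allSigns j)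

signOf : ∀ {j} → Vec Bool j → ℤ
signOf Vec.[] = + 1
signOf (true Vec.∷ e) = signOf e
signOf (false Vec.∷ e) = - signOf e

vtx : ∀ {n j} → Vec (Subset n) j → (Fin j → Fin n) → Fin j → Bool → Subset n
vtx x s i true  = lookup x i
vtx x s i false = ⁅ s i ⁆

sigma : ∀ {n j} → Vec (Subset n) j → (Fin j → Fin n) → Chain n
sigma x s = map (λ e → (signOf e , toList (tabulate (λ i → vtx x s i (lookup e i)))))
                (allSigns _)

comb : ∀ {n j} → (Vec (Subset n) j → Fin j → Fin n) → List (ℤ × NSPart n j) → Chain n
comb s L = concatMap (λ t → scale (proj₁ t) (sigma (blocks (proj₂ t)) (s (blocks (proj₂ t))))) L

-- combinatorial boundary of the j-cross-polytope: the 2j vertices x_i^{±1}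
-- are pairwise distinct, and the faces are exactly the choices of one of
-- each pair (the latter holds by construction of sigma).
CrossPolytope : ∀ {n j} → Vec (Subset n) j → (Fin j → Fin n) → Set
CrossPolytope {j = j} x s =
  ∀ (i i' : Fin j) (e e' : Bool) → vtx x s i e ≡ vtx x s i' e' → i ≡ i' × e ≡ e'

{-# OPTIONS --safe #-}
-- σ_F is the iterated suspension (x₁ − {s₁}) * ⋯ * (x_j − {s_j}) of the empty face, hence a cycle
-- whose faces choose one of x_i, {s_i} for every block.
--
-- Independence: the face {x₁, …, x_j} of σ_F has no singleton, so it occurs in σ_F with coefficient 1
-- and in no other σ_G; and it lies in no boundary, since it covers [n] and so is a maximal face.
--
-- Spanning, by induction on the number of blocks and on the ground set U: pick u ∈ U and cone off at
-- {u} the faces of a cycle z that avoid u. The rest of z, grouped by the block V ∋ u (V ≠ {u}) it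
-- uses, is Σ_V (V − {u}) * lk_V z, and each link lk_V z is a cycle on U ∖ V with one block fewer.
-- The resulting iterated suspensions are the σ_F up to reordering the blocks, which changes the sign,
-- and up to the choice of the points s_i, which changes σ_F by a boundary.
module Submission where

open import Defs
open import Data.Nat using (ℕ; zero; suc; pred; _≤_; _<_; s≤s)
import Data.Nat.Properties as NP
open import Data.Bool using (Bool; true; false; T; _∨_; _∧_; not; if_then_else_)
import Data.Bool.Properties as BP
open import Data.Unit using (tt)
open import Data.Empty using (⊥; ⊥-elim)
open import Data.Sum using (_⊎_; inj₁; inj₂)
open import Data.Product using (Σ; _×_; _,_; proj₁; proj₂)
open import Data.Integer using (ℤ; +_; -_; _*_; _+_)
import Data.Integer.Properties as ZP
open import Data.Integer.Tactic.RingSolver using (solve-∀)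
open import Data.Fin using (Fin; zero; suc)
import Data.Fin.Properties as FP
open import Data.Fin.Subset using (Subset; _∈_; _⊆_; ⁅_⁆; ∣_∣; Nonempty; _∩_; ∁; ⊤)
import Data.Fin.Subset.Properties as SP
open import Data.List using (List; []; _∷_; _++_; length; map; concatMap)
import Data.List.Properties as LP
open import Data.List.Relation.Unary.All using (All; []; _∷_)
import Data.List.Relation.Unary.All as All
import Data.List.Relation.Unary.All.Properties as AllP
open import Data.List.Relation.Unary.Any using (Any; here; there)
import Data.List.Relation.Unary.Any.Properties as AnyP
open import Data.List.Relation.Unary.AllPairs using (AllPairs; []; _∷_)
import Data.List.Relation.Unary.AllPairs as AllPairs
import Data.List.Relation.Unary.AllPairs.Properties as AllPairsP
open import Data.List.Relation.Unary.Linked using (Linked; _∷_)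
import Data.List.Relation.Unary.Linked.Properties as LkP
open import Data.Vec using (Vec; lookup; tabulate; toList)
import Data.Vec.Properties as VP
open import Relation.Binary.PropositionalEquality
open import Relation.Nullary using (yes; no; Dec)
open import Relation.Nullary.Decidable using (isYes; ¬?; _×-dec_)

private variable n : ℕ

true≢false : true ≢ false
true≢false ()

not≡true⇒≡false : ∀ b → not b ≡ true → b ≡ false
not≡true⇒≡false false _ = refl

All-dropMiddle : ∀ {A : Set} {Q : A → Set} (α : List A) (V : A) (β : List A) → All Q (α ++ V ∷ β) → All Q (α ++ β)
All-dropMiddle [] V β (_ ∷ h) = h
All-dropMiddle (x ∷ α) V β (q ∷ h) = q ∷ All-dropMiddle α V β h

All-middle : ∀ {A : Set} {Q : A → Set} (α : List A) (V : A) (β : List A) → All Q (α ++ V ∷ β) → Q V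
All-middle [] V β (q ∷ _) = q
All-middle (x ∷ α) V β (_ ∷ h) = All-middle α V β h

AllPairs-dropMiddle : ∀ {A : Set} {R : A → A → Set} (α : List A) (V : A) (β : List A) → AllPairs R (α ++ V ∷ β) → AllPairs R (α ++ β)
AllPairs-dropMiddle [] V β (_ ∷ h) = h
AllPairs-dropMiddle (x ∷ α) V β (q ∷ h) = All-dropMiddle α V β q ∷ AllPairs-dropMiddle α V β h

AllPairs-middle : ∀ {A : Set} {R : A → A → Set} (α : List A) (V : A) (β : List A) → AllPairs R (α ++ V ∷ β) →
  All (λ W → R W V) α × All (R V) β
AllPairs-middle [] V β (q ∷ _) = [] , q
AllPairs-middle (x ∷ α) V β (q ∷ h) = (All-middle α V β q ∷ proj₁ (AllPairs-middle α V β h)) , proj₂ (AllPairs-middle α V β h)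

AllPairs-withAll : ∀ {A : Set} {Q : A → Set} {R : A → A → Set} (l : List A) → All Q l → AllPairs R l → AllPairs (λ p q → Q p × R p q) l
AllPairs-withAll [] [] [] = []
AllPairs-withAll (x ∷ l) (q ∷ qs) (r ∷ rs) = All.map (λ r' → q , r') r ∷ AllPairs-withAll l qs rs

length-middle : ∀ {A : Set} (α : List A) (V : A) (β : List A) → length (α ++ V ∷ β) ≡ suc (length (α ++ β))
length-middle [] V β = refl
length-middle (x ∷ α) V β = cong suc (length-middle α V β)

length-dropMiddle : ∀ {A : Set} {k} (α : List A) (V : A) (β : List A) → length (α ++ V ∷ β) ≡ suc k → length (α ++ β) ≡ k
length-dropMiddle α V β e = NP.suc-injective (trans (sym (length-middle α V β)) e)

vecOfList : ∀ {A : Set} (l : List A) (j : ℕ) → length l ≡ j → Σ (Vec A j) λ v → toList v ≡ l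
vecOfList [] zero e = Vec.[] , refl
vecOfList (a ∷ l) (suc j) e with vecOfList l j (cong pred e)
... | v , p = a Vec.∷ v , cong (a ∷_) p

All-lookup : ∀ {A : Set} {Q : A → Set} {j} (v : Vec A j) → All Q (toList v) → ∀ i → Q (lookup v i)
All-lookup (x Vec.∷ v) (q ∷ qs) zero = q
All-lookup (x Vec.∷ v) (q ∷ qs) (suc i) = All-lookup v qs i

negOnePow : ℕ → ℤ
negOnePow zero = + 1
negOnePow (suc k) = - negOnePow k

data IsSign : ℤ → Set where
  one : IsSign (+ 1)
  minusOne : IsSign (- (+ 1))

isSign-neg : ∀ {a} → IsSign a → IsSign (- a)
isSign-neg one = minusOne
isSign-neg minusOne = one

isSign-cancel : ∀ {a} → IsSign a → ∀ x → a * x ≡ + 0 → x ≡ + 0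
isSign-cancel one x h = trans (sym (ZP.*-identityˡ x)) h
isSign-cancel minusOne x h = trans (sym (ZP.neg-involutive x)) (trans (cong -_ (sym (ZP.-1*i≡-i x))) (cong -_ h))

ltS-irrefl : (x : Subset n) → ltS x x ≡ false
ltS-irrefl Vec.[] = refl
ltS-irrefl (false Vec.∷ x) = ltS-irrefl x
ltS-irrefl (true Vec.∷ x) = ltS-irrefl x

ltS-trans : (x y z : Subset n) → ltS x y ≡ true → ltS y z ≡ true → ltS x z ≡ true
ltS-trans Vec.[] Vec.[] Vec.[] () q
ltS-trans (false Vec.∷ x) (false Vec.∷ y) (false Vec.∷ z) p q = ltS-trans x y z p q
ltS-trans (false Vec.∷ x) (false Vec.∷ y) (true Vec.∷ z) p q = refl
ltS-trans (false Vec.∷ x) (true Vec.∷ y) (false Vec.∷ z) p ()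
ltS-trans (false Vec.∷ x) (true Vec.∷ y) (true Vec.∷ z) p q = refl
ltS-trans (true Vec.∷ x) (false Vec.∷ y) z () q
ltS-trans (true Vec.∷ x) (true Vec.∷ y) (false Vec.∷ z) p ()
ltS-trans (true Vec.∷ x) (true Vec.∷ y) (true Vec.∷ z) p q = ltS-trans x y z p q

ltS-total : (x y : Subset n) → x ≢ y → ltS x y ≡ true ⊎ ltS y x ≡ true
ltS-total Vec.[] Vec.[] ne = ⊥-elim (ne refl)
ltS-total (false Vec.∷ x) (false Vec.∷ y) ne = ltS-total x y (λ e → ne (cong (false Vec.∷_) e))
ltS-total (false Vec.∷ x) (true Vec.∷ y) ne = inj₁ refl
ltS-total (true Vec.∷ x) (false Vec.∷ y) ne = inj₂ refl
ltS-total (true Vec.∷ x) (true Vec.∷ y) ne = ltS-total x y (λ e → ne (cong (true Vec.∷_) e))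

ltS-asym : (x y : Subset n) → ltS x y ≡ true → ltS y x ≡ false
ltS-asym x y p with ltS y x in q
... | false = refl
... | true = ⊥-elim (BP.not-¬ (ltS-irrefl x) (ltS-trans x y x p q))

ltS⇒≢ : (x y : Subset n) → ltS x y ≡ true → x ≢ y
ltS⇒≢ x .x p refl with trans (sym p) (ltS-irrefl x)
... | ()

insertV : Subset n → List (Subset n) → List (Subset n)
insertV x l = proj₂ (insertS x l)

insertSign : Subset n → List (Subset n) → ℤ
insertSign x l = proj₁ (insertS x l)

sortV : List (Subset n) → List (Subset n)
sortV v = proj₂ (sortS v)

sortSign : List (Subset n) → ℤ
sortSign v = proj₁ (sortS v)

insertSign-isSign : (x : Subset n) (l : List (Subset n)) → IsSign (insertSign x l)
insertSign-isSign x [] = one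
insertSign-isSign x (y ∷ l) with ltS y x
... | true = isSign-neg (insertSign-isSign x l)
... | false = one

insertV-comm : (x y : Subset n) → ltS x y ≡ true → (l : List (Subset n)) →
  (insertV y (insertV x l) ≡ insertV x (insertV y l)) × (insertSign y (insertV x l) * insertSign x l ≡ - (insertSign x (insertV y l) * insertSign y l))
insertV-comm x y xy [] rewrite xy | ltS-asym x y xy = refl , refl
insertV-comm x y xy (e ∷ l) with ltS e x in ex | ltS e y in ey
... | true | true rewrite ex | ey =
  cong (e ∷_) (proj₁ ih) , trans (k1 (insertSign y (insertV x l)) (insertSign x l)) (trans (proj₂ ih) (cong -_ (sym (k1 (insertSign x (insertV y l)) (insertSign y l)))))
  where
  ih = insertV-comm x y xy l
  k1 : ∀ (a b : ℤ) → (- a) * (- b) ≡ a * b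
  k1 = solve-∀
... | true | false with () ← trans (sym (ltS-trans e x y ex xy)) ey
... | false | true rewrite xy | ey | ex = refl , k2 _
  where
  k2 : ∀ (a : ℤ) → (- - a) * + 1 ≡ - (+ 1 * (- a))
  k2 = solve-∀
... | false | false rewrite xy | ey | ltS-asym x y xy = refl , refl

sortV-swap : (x y : Subset n) (r : List (Subset n)) → x ≢ y →
  (sortV (x ∷ y ∷ r) ≡ sortV (y ∷ x ∷ r)) × (sortSign (x ∷ y ∷ r) ≡ - sortSign (y ∷ x ∷ r))
sortV-swap x y r ne with ltS-total x y ne
... | inj₁ xy = sym (proj₁ c) , alg (sortSign r) _ _ _ _ (proj₂ c)
  where
  c = insertV-comm x y xy (sortV r)
  alg : ∀ (s a b c d : ℤ) → b * c ≡ - (a * d) → (s * d) * a ≡ - ((s * c) * b)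
  alg s a b c d h = trans (k s a d) (trans (cong (λ t → - (s * t)) (sym h)) (cong -_ (sym (k' s c b))))
    where
    k : ∀ (s a d : ℤ) → (s * d) * a ≡ - (s * - (a * d))
    k = solve-∀
    k' : ∀ (s c b : ℤ) → (s * c) * b ≡ s * (b * c)
    k' = solve-∀
... | inj₂ yx = proj₁ c , alg (sortSign r) _ _ _ _ (proj₂ c)
  where
  c = insertV-comm y x yx (sortV r)
  alg : ∀ (s a b c d : ℤ) → a * d ≡ - (b * c) → (s * d) * a ≡ - ((s * c) * b)
  alg s a b c d h = trans (k s a d) (trans (cong (s *_) h) (k' s b c))
    where
    k : ∀ (s a d : ℤ) → (s * d) * a ≡ s * (a * d)
    k = solve-∀
    k' : ∀ (s b c : ℤ) → s * - (b * c) ≡ - ((s * c) * b)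
    k' = solve-∀

sortV-∷-cong : (x : Subset n) (v w : List (Subset n)) (k : ℤ) →
  sortV v ≡ sortV w → sortSign v ≡ k * sortSign w →
  (sortV (x ∷ v) ≡ sortV (x ∷ w)) × (sortSign (x ∷ v) ≡ k * sortSign (x ∷ w))
sortV-∷-cong x v w k e1 e2 = cong (insertV x) e1 ,
  trans (cong₂ _*_ e2 (cong (insertSign x) e1)) (ZP.*-assoc k (sortSign w) (insertSign x (sortV w)))

sortV-moveToFront : (α : List (Subset n)) (x : Subset n) (β : List (Subset n)) → All (x ≢_) α →
  (sortV (α ++ x ∷ β) ≡ sortV (x ∷ α ++ β)) × (sortSign (α ++ x ∷ β) ≡ negOnePow (length α) * sortSign (x ∷ α ++ β))
sortV-moveToFront [] x β [] = refl , sym (ZP.*-identityˡ _)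
sortV-moveToFront (y ∷ α) x β (ne ∷ nes) =
  trans (proj₁ t) (proj₁ sw) ,
  trans (proj₂ t) (trans (cong (negOnePow (length α) *_) (proj₂ sw)) (neg-move (negOnePow (length α)) _))
  where
  neg-move : ∀ (a b : ℤ) → a * - b ≡ (- a) * b
  neg-move = solve-∀
  ih = sortV-moveToFront α x β nes
  t = sortV-∷-cong y (α ++ x ∷ β) (x ∷ α ++ β) (negOnePow (length α)) (proj₁ ih) (proj₂ ih)
  sw = sortV-swap y x (α ++ β) (λ e → ne (sym e))

anyᵇ : (Subset n → Bool) → List (Subset n) → Bool
anyᵇ f [] = false
anyᵇ f (x ∷ l) = f x ∨ anyᵇ f l

anyᵇ-insertV : (f : Subset n → Bool) (x : Subset n) (l : List (Subset n)) →
  anyᵇ f (insertV x l) ≡ f x ∨ anyᵇ f l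
anyᵇ-insertV f x [] = refl
anyᵇ-insertV f x (e ∷ l) with ltS e x
... | true = trans (cong (f e ∨_) (anyᵇ-insertV f x l))
               (trans (sym (BP.∨-assoc (f e) (f x) _))
                 (trans (cong (_∨ anyᵇ f l) (BP.∨-comm (f e) (f x))) (BP.∨-assoc (f x) (f e) _)))
... | false = refl

anyᵇ-sortV : (f : Subset n → Bool) (v : List (Subset n)) → anyᵇ f (sortV v) ≡ anyᵇ f v
anyᵇ-sortV f [] = refl
anyᵇ-sortV f (x ∷ v) = trans (anyᵇ-insertV f x (sortV v)) (cong (f x ∨_) (anyᵇ-sortV f v))

anyᵇ-++ : (f : Subset n → Bool) (α β : List (Subset n)) → anyᵇ f (α ++ β) ≡ anyᵇ f α ∨ anyᵇ f β
anyᵇ-++ f [] β = refl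
anyᵇ-++ f (x ∷ α) β = trans (cong (f x ∨_) (anyᵇ-++ f α β)) (sym (BP.∨-assoc (f x) _ _))

_≟S_ : (x y : Subset n) → Dec (x ≡ y)
_≟S_ = VP.≡-dec BP._≟_

_≟L_ : (x y : List (Subset n)) → Dec (x ≡ y)
_≟L_ = LP.≡-dec (VP.≡-dec BP._≟_)

deleteV : Subset n → List (Subset n) → List (Subset n)
deleteV x [] = []
deleteV x (y ∷ l) with x ≟S y
... | yes _ = l
... | no _ = y ∷ deleteV x l

deleteV-insertV : (x : Subset n) (l : List (Subset n)) → deleteV x (insertV x l) ≡ l
deleteV-insertV x [] with x ≟S x
... | yes _ = refl
... | no ne = ⊥-elim (ne refl)
deleteV-insertV x (e ∷ l) with ltS e x in ex
... | true with x ≟S e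
...   | yes refl = ⊥-elim (ltS⇒≢ e x ex refl)
...   | no _ = cong (e ∷_) (deleteV-insertV x l)
deleteV-insertV x (e ∷ l) | false with x ≟S x
...   | yes _ = refl
...   | no ne = ⊥-elim (ne refl)

Term : ℕ → Set
Term n = ℤ × List (Subset n)

termCoeff : ℤ → List (Subset n) → List (Subset n) → ℤ
termCoeff a v τ with LP.≡-dec (VP.≡-dec BP._≟_) (proj₂ (sortS v)) τ
... | yes _ = proj₁ (sortS v) * a
... | no _ = + 0

coeff-cons : (a : ℤ) (v : List (Subset n)) (c : Chain n) (τ : List (Subset n)) →
  coeff ((a , v) ∷ c) τ ≡ termCoeff a v τ + coeff c τ
coeff-cons a v c τ with LP.≡-dec (VP.≡-dec BP._≟_) (proj₂ (sortS v)) τ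
... | yes _ = refl
... | no _ = sym (ZP.+-identityˡ _)

termCoeff-≡ : (a : ℤ) (v τ : List (Subset n)) → sortV v ≡ τ → termCoeff a v τ ≡ sortSign v * a
termCoeff-≡ a v τ e with LP.≡-dec (VP.≡-dec BP._≟_) (proj₂ (sortS v)) τ
... | yes _ = refl
... | no ne = ⊥-elim (ne e)

termCoeff-≢ : (a : ℤ) (v τ : List (Subset n)) → sortV v ≢ τ → termCoeff a v τ ≡ + 0
termCoeff-≢ a v τ ne with LP.≡-dec (VP.≡-dec BP._≟_) (proj₂ (sortS v)) τ
... | yes e = ⊥-elim (ne e)
... | no _ = refl

termCoeff-cong : (a b : ℤ) (v w : List (Subset n)) → sortV v ≡ sortV w → sortSign v * a ≡ sortSign w * b →
  ∀ τ → termCoeff a v τ ≡ termCoeff b w τ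
termCoeff-cong a b v w e1 e2 τ = go (sortV v ≟L τ)
  where
  go : Dec (sortV v ≡ τ) → termCoeff a v τ ≡ termCoeff b w τ
  go (yes e) = trans (termCoeff-≡ a v τ e) (trans e2 (sym (termCoeff-≡ b w τ (trans (sym e1) e))))
  go (no ne) = trans (termCoeff-≢ a v τ ne) (sym (termCoeff-≢ b w τ (λ e → ne (trans e1 e))))

-- _≈_ hides both chains behind a function type; this wrapper lets Agda infer them.
infix 4 _≋_
data _≋_ {n : ℕ} (c d : Chain n) : Set where
  ⟨_⟩ : c ≈ d → c ≋ d

≋⇒≈ : {c d : Chain n} → c ≋ d → c ≈ d
≋⇒≈ ⟨ p ⟩ = p

≋-refl : {c : Chain n} → c ≋ c
≋-refl = ⟨ (λ τ → refl) ⟩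

≋-sym : {c d : Chain n} → c ≋ d → d ≋ c
≋-sym ⟨ p ⟩ = ⟨ (λ τ → sym (p τ)) ⟩

≋-trans : {c d e : Chain n} → c ≋ d → d ≋ e → c ≋ e
≋-trans ⟨ p ⟩ ⟨ q ⟩ = ⟨ (λ τ → trans (p τ) (q τ)) ⟩

≡⇒≋ : {c d : Chain n} → c ≡ d → c ≋ d
≡⇒≋ refl = ≋-refl

coeff-++ : (c d : Chain n) (τ : List (Subset n)) → coeff (c ++ d) τ ≡ coeff c τ + coeff d τ
coeff-++ [] d τ = sym (ZP.+-identityˡ _)
coeff-++ ((a , v) ∷ c) d τ =
  trans (coeff-cons a v (c ++ d) τ)
   (trans (cong (_+_ (termCoeff a v τ)) (coeff-++ c d τ))
     (trans (sym (ZP.+-assoc (termCoeff a v τ) _ _)) (cong (_+ coeff d τ) (sym (coeff-cons a v c τ)))))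

++-cong : {c c' d d' : Chain n} → c ≋ c' → d ≋ d' → (c ++ d) ≋ (c' ++ d')
++-cong {c = c} {c'} {d} {d'} ⟨ p ⟩ ⟨ q ⟩ = ⟨ (λ τ →
  trans (coeff-++ c d τ) (trans (cong₂ _+_ (p τ) (q τ)) (sym (coeff-++ c' d' τ)))) ⟩

++-comm-≋ : (c d : Chain n) → (c ++ d) ≋ (d ++ c)
++-comm-≋ c d = ⟨ (λ τ → trans (coeff-++ c d τ) (trans (ZP.+-comm (coeff c τ) _) (sym (coeff-++ d c τ)))) ⟩

++-assoc-≋ : (c d e : Chain n) → ((c ++ d) ++ e) ≋ (c ++ (d ++ e))
++-assoc-≋ c d e = ≡⇒≋ (LP.++-assoc c d e)

++-identityʳ-≋ : (c : Chain n) → (c ++ []) ≋ c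
++-identityʳ-≋ c = ≡⇒≋ (LP.++-identityʳ c)

negChain : Chain n → Chain n
negChain = map (λ t → (- proj₁ t , proj₂ t))

termCoeff-neg : (a : ℤ) (v τ : List (Subset n)) → termCoeff (- a) v τ ≡ - termCoeff a v τ
termCoeff-neg a v τ with LP.≡-dec (VP.≡-dec BP._≟_) (proj₂ (sortS v)) τ
... | yes _ = sym (ZP.neg-distribʳ-* (proj₁ (sortS v)) a)
... | no _ = refl

coeff-neg : (c : Chain n) (τ : List (Subset n)) → coeff (negChain c) τ ≡ - coeff c τ
coeff-neg [] τ = refl
coeff-neg ((a , v) ∷ c) τ =
  trans (coeff-cons (- a) v (negChain c) τ)
   (trans (cong₂ _+_ (termCoeff-neg a v τ) (coeff-neg c τ))
     (trans (sym (ZP.neg-distrib-+ (termCoeff a v τ) _)) (cong -_ (sym (coeff-cons a v c τ)))))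

negChain-cong : {c d : Chain n} → c ≋ d → negChain c ≋ negChain d
negChain-cong {c = c} {d} ⟨ p ⟩ = ⟨ (λ τ → trans (coeff-neg c τ) (trans (cong -_ (p τ)) (sym (coeff-neg d τ)))) ⟩

negChain-involutive : (c : Chain n) → negChain (negChain c) ≋ c
negChain-involutive c = ⟨ (λ τ → trans (coeff-neg (negChain c) τ) (trans (cong -_ (coeff-neg c τ)) (ZP.neg-involutive _))) ⟩

negChain-++ : (c d : Chain n) → negChain (c ++ d) ≡ negChain c ++ negChain d
negChain-++ c d = LP.map-++ _ c d

++-negChain-≋[] : (c : Chain n) → (c ++ negChain c) ≋ []
++-negChain-≋[] c = ⟨ (λ τ → trans (coeff-++ c (negChain c) τ) (trans (cong (_+_ (coeff c τ)) (coeff-neg c τ)) (ZP.+-inverseʳ (coeff c τ)))) ⟩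

++-≋[]ˡ : {c : Chain n} → c ≋ [] → ∀ (d : Chain n) → (c ++ d) ≋ d
++-≋[]ˡ {c = c} ⟨ p ⟩ d = ⟨ (λ τ → trans (coeff-++ c d τ) (trans (cong (_+ coeff d τ) (p τ)) (ZP.+-identityˡ _))) ⟩

++-≋[]ʳ : {c : Chain n} → c ≋ [] → ∀ (d : Chain n) → (d ++ c) ≋ d
++-≋[]ʳ {c = c} p d = ≋-trans (++-comm-≋ d c) (++-≋[]ˡ p d)

coeff-scale : (a : ℤ) (c : Chain n) (τ : List (Subset n)) → coeff (scale a c) τ ≡ a * coeff c τ
coeff-scale a [] τ = sym (ZP.*-zeroʳ a)
coeff-scale a ((b , v) ∷ c) τ =
  trans (coeff-cons (a * b) v (scale a c) τ)
   (trans (cong₂ _+_ (k b v) (coeff-scale a c τ))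
     (trans (sym (ZP.*-distribˡ-+ a (termCoeff b v τ) _)) (cong (a *_) (sym (coeff-cons b v c τ)))))
  where
  k : ∀ b v → termCoeff (a * b) v τ ≡ a * termCoeff b v τ
  k b v = go (sortV v ≟L τ)
    where
    sa : ∀ s a b → s * (a * b) ≡ a * (s * b)
    sa = solve-∀
    go : Dec (sortV v ≡ τ) → termCoeff (a * b) v τ ≡ a * termCoeff b v τ
    go (yes e) = trans (termCoeff-≡ _ v τ e) (trans (sa (sortSign v) a b) (cong (a *_) (sym (termCoeff-≡ b v τ e))))
    go (no ne) = trans (termCoeff-≢ _ v τ ne) (trans (sym (ZP.*-zeroʳ a)) (cong (a *_) (sym (termCoeff-≢ b v τ ne))))

scale-cong : (a : ℤ) {c d : Chain n} → c ≋ d → scale a c ≋ scale a d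
scale-cong a {c} {d} ⟨ p ⟩ = ⟨ (λ τ → trans (coeff-scale a c τ) (trans (cong (a *_) (p τ)) (sym (coeff-scale a d τ)))) ⟩

∷-cong-≋ : (t : Term n) {c d : Chain n} → c ≋ d → (t ∷ c) ≋ (t ∷ d)
∷-cong-≋ t p = ++-cong {c = t ∷ []} {c' = t ∷ []} ≋-refl p

map-cong-≋ : (f g : Term n → Term n) →
  (∀ t τ → termCoeff (proj₁ (f t)) (proj₂ (f t)) τ ≡ termCoeff (proj₁ (g t)) (proj₂ (g t)) τ) →
  ∀ c → map f c ≋ map g c
map-cong-≋ f g h c = ⟨ go c ⟩
  where
  go : ∀ c τ → coeff (map f c) τ ≡ coeff (map g c) τ
  go [] τ = refl
  go (t ∷ c) τ = trans (coeff-cons (proj₁ (f t)) (proj₂ (f t)) (map f c) τ)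
    (trans (cong₂ _+_ (h t τ) (go c τ)) (sym (coeff-cons (proj₁ (g t)) (proj₂ (g t)) (map g c) τ)))

join : Subset n → Chain n → Chain n
join x = map (λ t → (proj₁ t , x ∷ proj₂ t))

joinCoeffDec : (x : Subset n) (τ : List (Subset n)) → Dec (insertV x (deleteV x τ) ≡ τ) → ℤ → ℤ
joinCoeffDec x τ (yes _) k = insertSign x (deleteV x τ) * k
joinCoeffDec x τ (no _) k = + 0

joinCoeff : Subset n → List (Subset n) → ℤ → ℤ
joinCoeff x τ k = joinCoeffDec x τ (insertV x (deleteV x τ) ≟L τ) k

joinCoeff-+ : (x : Subset n) (τ : List (Subset n)) (k1 k2 : ℤ) → joinCoeff x τ (k1 + k2) ≡ joinCoeff x τ k1 + joinCoeff x τ k2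
joinCoeff-+ x τ k1 k2 = go (insertV x (deleteV x τ) ≟L τ)
  where
  go : (d : Dec _) → joinCoeffDec x τ d (k1 + k2) ≡ joinCoeffDec x τ d k1 + joinCoeffDec x τ d k2
  go (yes _) = ZP.*-distribˡ-+ (insertSign x (deleteV x τ)) k1 k2
  go (no _) = refl

joinCoeff-0 : (x : Subset n) (τ : List (Subset n)) → joinCoeff x τ (+ 0) ≡ + 0
joinCoeff-0 x τ = go (insertV x (deleteV x τ) ≟L τ)
  where
  go : (d : Dec _) → joinCoeffDec x τ d (+ 0) ≡ + 0
  go (yes _) = ZP.*-zeroʳ (insertSign x (deleteV x τ))
  go (no _) = refl

termCoeff-join : (a : ℤ) (x : Subset n) (w τ : List (Subset n)) →
  termCoeff a (x ∷ w) τ ≡ joinCoeff x τ (termCoeff a w (deleteV x τ))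
termCoeff-join a x w τ = go (insertV x (sortV w) ≟L τ) (insertV x (deleteV x τ) ≟L τ)
  where
  go : Dec (insertV x (sortV w) ≡ τ) → (d : Dec (insertV x (deleteV x τ) ≡ τ)) →
       termCoeff a (x ∷ w) τ ≡ joinCoeffDec x τ d (termCoeff a w (deleteV x τ))
  go (yes e) (yes e2) =
    trans (termCoeff-≡ a (x ∷ w) τ e)
     (trans (alg (sortSign w) (insertSign x (sortV w)) a)
       (trans (cong (λ r → insertSign x r * (sortSign w * a)) e3)
         (cong (insertSign x (deleteV x τ) *_) (sym (termCoeff-≡ a w (deleteV x τ) e3)))))
    where
    e3 : sortV w ≡ deleteV x τ
    e3 = trans (sym (deleteV-insertV x (sortV w))) (cong (deleteV x) e)
    alg : ∀ s g a → (s * g) * a ≡ g * (s * a)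
    alg = solve-∀
  go (yes e) (no ne) = ⊥-elim (ne (trans (cong (insertV x) (trans (cong (deleteV x) (sym e)) (deleteV-insertV x (sortV w)))) e))
  go (no ne) (yes e2) =
    trans (termCoeff-≢ a (x ∷ w) τ ne)
      (trans (sym (ZP.*-zeroʳ (insertSign x (deleteV x τ)))) (cong (insertSign x (deleteV x τ) *_)
        (sym (termCoeff-≢ a w (deleteV x τ) (λ e3 → ne (trans (cong (insertV x) e3) e2))))))
  go (no ne) (no _) = termCoeff-≢ a (x ∷ w) τ ne

coeff-join : (x : Subset n) (c : Chain n) (τ : List (Subset n)) →
  coeff (join x c) τ ≡ joinCoeff x τ (coeff c (deleteV x τ))
coeff-join x [] τ = sym (joinCoeff-0 x τ)
coeff-join x ((a , w) ∷ c) τ =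
  trans (coeff-cons a (x ∷ w) (join x c) τ)
   (trans (cong₂ _+_ (termCoeff-join a x w τ) (coeff-join x c τ))
     (trans (sym (joinCoeff-+ x τ _ _)) (cong (joinCoeff x τ) (sym (coeff-cons a w c (deleteV x τ))))))

join-cong : (x : Subset n) {c d : Chain n} → c ≋ d → join x c ≋ join x d
join-cong x {c} {d} ⟨ p ⟩ = ⟨ (λ τ → trans (coeff-join x c τ) (trans (cong (joinCoeff x τ) (p (deleteV x τ))) (sym (coeff-join x d τ)))) ⟩

joinCoeff-insertV : (x : Subset n) (τ : List (Subset n)) (k : ℤ) → insertV x (deleteV x τ) ≡ τ → joinCoeff x τ k ≡ insertSign x (deleteV x τ) * k
joinCoeff-insertV x τ k e = go (insertV x (deleteV x τ) ≟L τ)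
  where
  go : (d : Dec _) → joinCoeffDec x τ d k ≡ insertSign x (deleteV x τ) * k
  go (yes _) = refl
  go (no ne) = ⊥-elim (ne e)

join-≋[] : (x : Subset n) {c : Chain n} → join x c ≋ [] → c ≋ []
join-≋[] x {c} ⟨ p ⟩ = ⟨ (λ ρ → isSign-cancel (insertSign-isSign x ρ) (coeff c ρ)
     (trans (cong (λ r → insertSign x r * coeff c r) (sym (deleteV-insertV x ρ)))
       (trans (sym (joinCoeff-insertV x (insertV x ρ) _ (cong (insertV x) (deleteV-insertV x ρ))))
         (trans (sym (coeff-join x c (insertV x ρ))) (p (insertV x ρ)))))) ⟩

join-negChain : (x : Subset n) (c : Chain n) → join x (negChain c) ≡ negChain (join x c)
join-negChain x [] = refl
join-negChain x (t ∷ c) = cong (_ ∷_) (join-negChain x c)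

join-++ : (x : Subset n) (c d : Chain n) → join x (c ++ d) ≡ join x c ++ join x d
join-++ x c d = LP.map-++ _ c d

join-scale : (x : Subset n) (a : ℤ) (c : Chain n) → join x (scale a c) ≡ scale a (join x c)
join-scale x a [] = refl
join-scale x a (t ∷ c) = cong (_ ∷_) (join-scale x a c)

join-swap : (y V : Subset n) → y ≢ V → (c : Chain n) → join y (join V c) ≋ negChain (join V (join y c))
join-swap y V ne c = ≋-trans (≡⇒≋ (sym (LP.map-∘ c))) (≋-trans (map-cong-≋ _ _ h c) (≡⇒≋ (trans (LP.map-∘ c) (cong negChain (LP.map-∘ c)))))
  where
  h : ∀ (t : Term _) τ → termCoeff (proj₁ t) (y ∷ V ∷ proj₂ t) τ ≡ termCoeff (- proj₁ t) (V ∷ y ∷ proj₂ t) τ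
  h (a , w) τ = termCoeff-cong a (- a) (y ∷ V ∷ w) (V ∷ y ∷ w) (proj₁ sw)
     (trans (cong (_* a) (proj₂ sw)) (nl (sortSign (V ∷ y ∷ w)) a)) τ
    where
    sw = sortV-swap y V w ne
    nl : ∀ s a → (- s) * a ≡ s * - a
    nl = solve-∀

filterChain : (List (Subset n) → Bool) → Chain n → Chain n
filterChain p [] = []
filterChain p ((a , v) ∷ c) = if p v then (a , v) ∷ filterChain p c else filterChain p c

SortInvariant : (List (Subset n) → Bool) → Set
SortInvariant {n} p = ∀ (v : List (Subset n)) → p (sortV v) ≡ p v

coeff-filterChain : (p : List (Subset n) → Bool) → SortInvariant p → (c : Chain n) (τ : List (Subset n)) →
  coeff (filterChain p c) τ ≡ (if p τ then coeff c τ else + 0)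
coeff-filterChain p inv [] τ with p τ
... | true = refl
... | false = refl
coeff-filterChain p inv ((a , v) ∷ c) τ with p v in pv | p τ in pt
... | true | true = trans (coeff-cons a v _ τ) (trans (cong (_+_ (termCoeff a v τ)) (trans (coeff-filterChain p inv c τ) (cong (λ b → if b then coeff c τ else + 0) pt))) (sym (coeff-cons a v c τ)))
... | true | false = trans (coeff-cons a v _ τ) (trans (cong₂ _+_ (termCoeff-≢ a v τ ne) (trans (coeff-filterChain p inv c τ) (cong (λ b → if b then coeff c τ else + 0) pt))) refl)
  where
  ne : sortV v ≢ τ
  ne e with () ← trans (sym pt) (trans (cong p (sym e)) (trans (inv v) pv))
... | false | true = trans (trans (coeff-filterChain p inv c τ) (cong (λ b → if b then coeff c τ else + 0) pt))
     (trans (sym (ZP.+-identityˡ _)) (trans (cong (_+ coeff c τ) (sym (termCoeff-≢ a v τ ne))) (sym (coeff-cons a v c τ))))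
  where
  ne : sortV v ≢ τ
  ne e with () ← trans (sym pt) (trans (cong p (sym e)) (trans (inv v) pv))
... | false | false = trans (coeff-filterChain p inv c τ) (cong (λ b → if b then coeff c τ else + 0) pt)

filterChain-cong : (p : List (Subset n) → Bool) → SortInvariant p → {c d : Chain n} → c ≋ d → filterChain p c ≋ filterChain p d
filterChain-cong p inv {c} {d} ⟨ q ⟩ = ⟨ (λ τ → trans (coeff-filterChain p inv c τ) (trans (cong (λ k → if p τ then k else + 0) (q τ)) (sym (coeff-filterChain p inv d τ)))) ⟩

filterChain-all : (p : List (Subset n) → Bool) (c : Chain n) → All (λ t → p (proj₂ t) ≡ true) c → filterChain p c ≡ c
filterChain-all p [] [] = refl
filterChain-all p ((a , v) ∷ c) (h ∷ hs) rewrite h = cong (_ ∷_) (filterChain-all p c hs)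

filterChain-none : (p : List (Subset n) → Bool) (c : Chain n) → All (λ t → p (proj₂ t) ≡ false) c → filterChain p c ≡ []
filterChain-none p [] [] = refl
filterChain-none p ((a , v) ∷ c) (h ∷ hs) rewrite h = filterChain-none p c hs

filterChain-++ : (p : List (Subset n) → Bool) (c d : Chain n) → filterChain p (c ++ d) ≡ filterChain p c ++ filterChain p d
filterChain-++ p [] d = refl
filterChain-++ p ((a , v) ∷ c) d with p v
... | true = cong (_ ∷_) (filterChain-++ p c d)
... | false = filterChain-++ p c d

filterChain-join : (p : List (Subset n) → Bool) (x : Subset n) → (∀ w → p (x ∷ w) ≡ p w) → (c : Chain n) →
  filterChain p (join x c) ≡ join x (filterChain p c)
filterChain-join p x h [] = refl
filterChain-join p x h ((a , w) ∷ c) rewrite h w with p w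
... | true = cong (_ ∷_) (filterChain-join p x h c)
... | false = filterChain-join p x h c

∂-++ : (c d : Chain n) → ∂ (c ++ d) ≡ ∂ c ++ ∂ d
∂-++ [] d = refl
∂-++ ((a , v) ∷ c) d = trans (cong (∂term a v ++_) (∂-++ c d)) (sym (LP.++-assoc (∂term a v) (∂ c) (∂ d)))

∂term-neg : (a : ℤ) (v : List (Subset n)) → ∂term (- a) v ≡ negChain (∂term a v)
∂term-neg a [] = refl
∂term-neg a (x ∷ v) = cong ((- a , v) ∷_) (trans (cong (join x) (∂term-neg (- a) v)) (join-negChain x _))

∂-neg : (c : Chain n) → ∂ (negChain c) ≡ negChain (∂ c)
∂-neg [] = refl
∂-neg ((a , v) ∷ c) = trans (cong₂ _++_ (∂term-neg a v) (∂-neg c)) (sym (negChain-++ (∂term a v) (∂ c)))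

++-leftComm-≋ : (A c B : Chain n) → (A ++ (c ++ B)) ≋ (c ++ (A ++ B))
++-leftComm-≋ A c B = ≋-trans (≡⇒≋ (sym (LP.++-assoc A c B))) (≋-trans (++-cong (++-comm-≋ A c) ≋-refl) (≡⇒≋ (LP.++-assoc c A B)))

∂-join : (x : Subset n) (c : Chain n) → ∂ (join x c) ≋ (c ++ negChain (join x (∂ c)))
∂-join x [] = ≋-refl
∂-join x ((a , w) ∷ c) =
  ∷-cong-≋ (a , w)
   (≋-trans (++-cong {c = join x (∂term (- a) w)} ≋-refl (∂-join x c))
    (≋-trans (≡⇒≋ (cong (_++ (c ++ negChain (join x (∂ c)))) (trans (cong (join x) (∂term-neg a w)) (join-negChain x _))))
     (≋-trans (++-leftComm-≋ (negChain (join x (∂term a w))) c (negChain (join x (∂ c))))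
       (≡⇒≋ (cong (c ++_) (trans (sym (negChain-++ (join x (∂term a w)) (join x (∂ c)))) (cong negChain (sym (join-++ x (∂term a w) (∂ c))))))))))

++-congʳ : (c : Chain n) {d d' : Chain n} → d ≋ d' → (c ++ d) ≋ (c ++ d')
++-congʳ c p = ++-cong {c = c} {c' = c} ≋-refl p

++-congˡ : {c c' : Chain n} (d : Chain n) → c ≋ c' → (c ++ d) ≋ (c' ++ d)
++-congˡ {c = c} {c'} d p = ++-cong {d = d} {d' = d} p ≋-refl

disjoint-intro : {p q : Subset n} → (∀ {x} → x ∈ p → x ∈ q → ⊥) → Disjoint p q
disjoint-intro {p = p} {q} f (x , m) = let (a , b) = SP.x∈p∩q⁻ p q m in f a b

disjoint-elim : {p q : Subset n} → Disjoint p q → ∀ {x} → x ∈ p → x ∈ q → ⊥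
disjoint-elim d a b = d (_ , SP.x∈p∩q⁺ (a , b))

disjoint-sym : {p q : Subset n} → Disjoint p q → Disjoint q p
disjoint-sym d = disjoint-intro (λ a b → disjoint-elim d b a)

disjoint-⊆ʳ : {p q r : Subset n} → Disjoint p q → r ⊆ q → Disjoint p r
disjoint-⊆ʳ d s = disjoint-intro (λ a b → disjoint-elim d a (s b))

disjoint-⊆ˡ : {p q r : Subset n} → Disjoint p q → r ⊆ p → Disjoint r q
disjoint-⊆ˡ d s = disjoint-intro (λ a b → disjoint-elim d (s a) b)

⁅x⁆⊆ : {t : Fin n} {B : Subset n} → t ∈ B → ⁅ t ⁆ ⊆ B
⁅x⁆⊆ {t = t} m x rewrite SP.x∈⁅y⁆⇒x≡y t x = m

⁅x⁆-nonempty : (t : Fin n) → Nonempty ⁅ t ⁆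
⁅x⁆-nonempty t = t , SP.x∈⁅x⁆ t

⊆-∩∁ : {U V W : Subset n} → W ⊆ U → Disjoint V W → W ⊆ U ∩ ∁ V
⊆-∩∁ s d xm = SP.x∈p∩q⁺ (s xm , SP.x∉p⇒x∈∁p (λ xv → disjoint-elim d xv xm))

disjoint-∩∁ : {U V W : Subset n} → W ⊆ U ∩ ∁ V → Disjoint V W
disjoint-∩∁ s = disjoint-intro (λ xv xw → SP.x∈∁p⇒x∉p (proj₂ (SP.x∈p∩q⁻ _ _ (s xw))) xv)

∩∁-⊆ : {U V W : Subset n} → W ⊆ U ∩ ∁ V → W ⊆ U
∩∁-⊆ s xw = proj₁ (SP.x∈p∩q⁻ _ _ (s xw))

-- Suspensions and the cycles σ_F
AllDisjoint : Subset n → Chain n → Set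
AllDisjoint x c = All (λ t → All (Disjoint x) (proj₂ t)) c

join-isChainOf : ∀ {k} (x : Subset n) (c : Chain n) → Nonempty x → AllDisjoint x c → IsChainOf k c → IsChainOf (suc k) (join x c)
join-isChainOf x [] ne [] [] = []
join-isChainOf x (t ∷ c) ne (d ∷ ds) ((l , fa , fp) ∷ hs) = (cong suc l , (ne ∷ fa) , (d ∷ fp)) ∷ join-isChainOf x c ne ds hs

negChain-isChainOf : ∀ {k} (c : Chain n) → IsChainOf k c → IsChainOf k (negChain c)
negChain-isChainOf [] [] = []
negChain-isChainOf (t ∷ c) (h ∷ hs) = h ∷ negChain-isChainOf c hs

negChain-All : ∀ {Q : List (Subset n) → Set} (c : Chain n) → All (λ t → Q (proj₂ t)) c → All (λ t → Q (proj₂ t)) (negChain c)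
negChain-All [] [] = []
negChain-All (t ∷ c) (h ∷ hs) = h ∷ negChain-All c hs

scale-All : ∀ {Q : List (Subset n) → Set} (a : ℤ) (c : Chain n) → All (λ t → Q (proj₂ t)) c → All (λ t → Q (proj₂ t)) (scale a c)
scale-All a [] [] = []
scale-All a (t ∷ c) (h ∷ hs) = h ∷ scale-All a c hs

join-All : ∀ {Q : List (Subset n) → Set} (x : Subset n) (c : Chain n) → All (λ t → Q (x ∷ proj₂ t)) c → All (λ t → Q (proj₂ t)) (join x c)
join-All x [] [] = []
join-All x (t ∷ c) (h ∷ hs) = h ∷ join-All x c hs

suspend : Subset n → Fin n → Chain n → Chain n
suspend B t c = join B c ++ negChain (join ⁅ t ⁆ c)

crossCycle : List (Subset n × Fin n) → Chain n
crossCycle [] = (+ 1 , []) ∷ []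
crossCycle ((B , t) ∷ ps) = suspend B t (crossCycle ps)

suspend-cong : (B : Subset n) (t : Fin n) {c d : Chain n} → c ≋ d → suspend B t c ≋ suspend B t d
suspend-cong B t p = ++-cong (join-cong B p) (negChain-cong (join-cong ⁅ t ⁆ p))

suspend-++ : (B : Subset n) (t : Fin n) (c d : Chain n) → suspend B t (c ++ d) ≋ (suspend B t c ++ suspend B t d)
suspend-++ B t c d rewrite join-++ B c d | join-++ ⁅ t ⁆ c d | negChain-++ (join ⁅ t ⁆ c) (join ⁅ t ⁆ d) =
  ≋-trans (++-assoc-≋ X Y (Z ++ W)) (≋-trans (++-congʳ X (++-leftComm-≋ Y Z W)) (≋-sym (++-assoc-≋ X Z (Y ++ W))))
  where
  X = join B c
  Y = join B d
  Z = negChain (join ⁅ t ⁆ c)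
  W = negChain (join ⁅ t ⁆ d)

∂-suspend : (B : Subset n) (t : Fin n) (c : Chain n) → ∂ (suspend B t c) ≋ negChain (suspend B t (∂ c))
∂-suspend B t c rewrite ∂-++ (join B c) (negChain (join ⁅ t ⁆ c)) | ∂-neg (join ⁅ t ⁆ c) =
  ≋-trans (++-cong (∂-join B c) (negChain-cong (∂-join ⁅ t ⁆ c)))
   (≋-trans (≡⇒≋ (cong ((c ++ negChain (join B (∂ c))) ++_) (negChain-++ c (negChain (join ⁅ t ⁆ (∂ c))))))
    (≋-trans (++-assoc-≋ c (negChain (join B (∂ c))) (negChain c ++ W))
     (≋-trans (++-congʳ c (++-leftComm-≋ (negChain (join B (∂ c))) (negChain c) W))
      (≋-trans (≋-sym (++-assoc-≋ c (negChain c) (negChain (join B (∂ c)) ++ W)))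
       (≋-trans (++-≋[]ˡ (++-negChain-≋[] c) (negChain (join B (∂ c)) ++ W))
          (≡⇒≋ (sym (negChain-++ (join B (∂ c)) _))))))))
  where
  W = negChain (negChain (join ⁅ t ⁆ (∂ c)))

∂-crossCycle : (ps : List (Subset n × Fin n)) → ∂ (crossCycle ps) ≋ []
∂-crossCycle [] = ≋-refl
∂-crossCycle ((B , t) ∷ ps) = ≋-trans (∂-suspend B t (crossCycle ps)) (negChain-cong (suspend-cong B t (∂-crossCycle ps)))

blockPairs : ∀ {j} → Vec (Subset n) j → (Fin j → Fin n) → List (Subset n × Fin n)
blockPairs Vec.[] s = []
blockPairs (x Vec.∷ xs) s = (x , s zero) ∷ blockPairs xs (λ i → s (suc i))

vtx-suc : ∀ {j} (x : Subset n) (xs : Vec (Subset n) j) (s : Fin (suc j) → Fin n) (i : Fin j) (b : Bool) →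
  vtx (x Vec.∷ xs) s (suc i) b ≡ vtx xs (λ k → s (suc k)) i b
vtx-suc x xs s i true = refl
vtx-suc x xs s i false = refl

sigma≡crossCycle : ∀ {j} (x : Vec (Subset n) j) (s : Fin j → Fin n) → sigma x s ≡ crossCycle (blockPairs x s)
sigma≡crossCycle Vec.[] s = refl
sigma≡crossCycle {j = suc j} (x Vec.∷ xs) s =
  trans (LP.map-++ f (map (true Vec.∷_) A) (map (false Vec.∷_) A))
   (trans (cong₂ _++_ (trans (sym (LP.map-∘ A)) (trans (LP.map-cong h1 A) (LP.map-∘ A)))
                      (trans (sym (LP.map-∘ A)) (trans (LP.map-cong h2 A) (trans (LP.map-∘ A) (cong negChain (LP.map-∘ A))))))
     (cong (λ c → join x c ++ negChain (join ⁅ s zero ⁆ c)) (sigma≡crossCycle xs (λ i → s (suc i)))))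
  where
  A = allSigns j
  s' : Fin j → Fin _
  s' i = s (suc i)
  f : Vec Bool (suc j) → Term _
  f e = (signOf e , toList (tabulate (λ i → vtx (x Vec.∷ xs) s i (lookup e i))))
  f' : Vec Bool j → Term _
  f' e = (signOf e , toList (tabulate (λ i → vtx xs s' i (lookup e i))))
  tl : ∀ e → tabulate (λ i → vtx (x Vec.∷ xs) s (suc i) (lookup e i)) ≡ tabulate (λ i → vtx xs s' i (lookup e i))
  tl e = VP.tabulate-cong (λ i → vtx-suc x xs s i (lookup e i))
  h1 : ∀ e → f (true Vec.∷ e) ≡ (proj₁ (f' e) , x ∷ proj₂ (f' e))
  h1 e = cong (λ v → (signOf e , x ∷ toList v)) (tl e)
  h2 : ∀ e → f (false Vec.∷ e) ≡ (- proj₁ (f' e) , ⁅ s zero ⁆ ∷ proj₂ (f' e))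
  h2 e = cong (λ v → (- signOf e , ⁅ s zero ⁆ ∷ toList v)) (tl e)

ValidPairs : List (Subset n × Fin n) → Set
ValidPairs ps = All (λ p → proj₂ p ∈ proj₁ p) ps × AllPairs (λ p q → Disjoint (proj₁ p) (proj₁ q)) ps

VerticesWithin : List (Subset n × Fin n) → Chain n → Set
VerticesWithin ps c = All (λ t → All (λ V → Any (λ p → V ⊆ proj₁ p) ps) (proj₂ t)) c

crossCycle-verticesWithin : (ps : List (Subset n × Fin n)) → All (λ p → proj₂ p ∈ proj₁ p) ps → VerticesWithin ps (crossCycle ps)
crossCycle-verticesWithin [] [] = (([]) ∷ [])
crossCycle-verticesWithin ((B , t) ∷ ps) (m ∷ ms) =
  AllP.++⁺ (join-All B (crossCycle ps) (All.map (λ h → here (λ z → z) ∷ All.map there h) ih))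
           (negChain-All (join ⁅ t ⁆ (crossCycle ps)) (join-All ⁅ t ⁆ (crossCycle ps) (All.map (λ h → here (⁅x⁆⊆ m) ∷ All.map there h) ih)))
  where
  ih = crossCycle-verticesWithin ps ms

disjoint-within : {B V : Subset n} (ps : List (Subset n × Fin n)) → All (λ p → Disjoint B (proj₁ p)) ps →
  Any (λ p → V ⊆ proj₁ p) ps → Disjoint B V
disjoint-within (p ∷ ps) (d ∷ ds) (here s) = disjoint-⊆ʳ d s
disjoint-within (p ∷ ps) (d ∷ ds) (there a) = disjoint-within ps ds a

crossCycle-isChainOf : (ps : List (Subset n × Fin n)) → ValidPairs ps → IsChainOf (length ps) (crossCycle ps)
crossCycle-isChainOf [] _ = (refl , [] , []) ∷ []
crossCycle-isChainOf ((B , t) ∷ ps) (m ∷ ms , d ∷ ds) =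
  AllP.++⁺ (join-isChainOf B (crossCycle ps) (t , m) (All.map (All.map (disjoint-within ps d)) vin) ih)
           (negChain-isChainOf _ (join-isChainOf ⁅ t ⁆ (crossCycle ps) (⁅x⁆-nonempty t)
              (All.map (All.map (λ a → disjoint-⊆ˡ (disjoint-within ps d a) (⁅x⁆⊆ m))) vin) ih))
  where
  ih = crossCycle-isChainOf ps (ms , ds)
  vin = crossCycle-verticesWithin ps ms

blockPairs-length : ∀ {j} (x : Vec (Subset n) j) (s : Fin j → Fin n) → length (blockPairs x s) ≡ j
blockPairs-length Vec.[] s = refl
blockPairs-length (x Vec.∷ xs) s = cong suc (blockPairs-length xs _)

blockPairs-∈ : ∀ {j} (x : Vec (Subset n) j) (s : Fin j → Fin n) → (∀ i → s i ∈ lookup x i) →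
  All (λ p → proj₂ p ∈ proj₁ p) (blockPairs x s)
blockPairs-∈ Vec.[] s h = []
blockPairs-∈ (x Vec.∷ xs) s h = h zero ∷ blockPairs-∈ xs _ (λ i → h (suc i))

blockPairs-disjoint : ∀ {j} (x : Vec (Subset n) j) (s : Fin j → Fin n) → AllPairs Disjoint (toList x) →
  AllPairs (λ p q → Disjoint (proj₁ p) (proj₁ q)) (blockPairs x s)
blockPairs-disjoint Vec.[] s [] = []
blockPairs-disjoint (x Vec.∷ xs) s (d ∷ ds) = go xs (λ i → s (suc i)) d ∷ blockPairs-disjoint xs _ ds
  where
  go : ∀ {j} (ys : Vec (Subset _) j) (s : Fin j → Fin _) → All (Disjoint x) (toList ys) →
       All (λ q → Disjoint x (proj₁ q)) (blockPairs ys s)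
  go Vec.[] s [] = []
  go (y Vec.∷ ys) s (e ∷ es) = e ∷ go ys _ es

lookup-disjoint : ∀ {j} (x : Vec (Subset n) j) → AllPairs Disjoint (toList x) → (i i' : Fin j) → i ≢ i' →
  Disjoint (lookup x i) (lookup x i')
lookup-disjoint (x Vec.∷ xs) (d ∷ ds) zero zero ne = ⊥-elim (ne refl)
lookup-disjoint (x Vec.∷ xs) (d ∷ ds) zero (suc i') ne = go xs d i'
  where
  go : ∀ {j} (ys : Vec (Subset _) j) → All (Disjoint x) (toList ys) → ∀ k → Disjoint x (lookup ys k)
  go (y Vec.∷ ys) (e ∷ es) zero = e
  go (y Vec.∷ ys) (e ∷ es) (suc k) = go ys es k
lookup-disjoint (x Vec.∷ xs) (d ∷ ds) (suc i) zero ne = disjoint-sym (lookup-disjoint (x Vec.∷ xs) (d ∷ ds) zero (suc i) (λ e → ne (sym e)))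
lookup-disjoint (x Vec.∷ xs) (d ∷ ds) (suc i) (suc i') ne = lookup-disjoint xs ds i i' (λ e → ne (cong suc e))

sigma-isCrossPolytopeCycle : ∀ {j} (F : NSPart n j) (s : Fin j → Fin n) → (∀ i → s i ∈ lookup (blocks F) i) →
    IsChainOf j (sigma (blocks F) s) × ∂ (sigma (blocks F) s) ≈ [] × CrossPolytope (blocks F) s
sigma-isCrossPolytopeCycle {j = j} F sx hs = ch , cyc , cp
  where
  x = blocks F
  ps = blockPairs x sx
  ok : ValidPairs ps
  ok = blockPairs-∈ x sx hs , blockPairs-disjoint x sx (disjoint F)
  ch : IsChainOf j (sigma x sx)
  ch rewrite sigma≡crossCycle x sx = subst (λ k → IsChainOf k (crossCycle ps)) (blockPairs-length x sx) (crossCycle-isChainOf ps ok)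
  cyc : ∂ (sigma x sx) ≈ []
  cyc rewrite sigma≡crossCycle x sx = ≋⇒≈ (∂-crossCycle ps)
  sing : ∀ i t → lookup x i ≢ ⁅ t ⁆
  sing i t e with subst (λ k → 2 ≤ k) (trans (cong ∣_∣ e) (SP.∣⁅x⁆∣≡1 t)) (big F i)
  ... | s≤s ()
  cp : CrossPolytope x sx
  cp i i' true true e with i FP.≟ i'
  ... | yes eq = eq , refl
  ... | no ne = ⊥-elim (disjoint-elim (lookup-disjoint x (disjoint F) i i' ne) (hs i) (subst (sx i ∈_) e (hs i)))
  cp i i' true false e = ⊥-elim (sing i (sx i') e)
  cp i i' false true e = ⊥-elim (sing i' (sx i) (sym e))
  cp i i' false false e with i FP.≟ i'
  ... | yes eq = eq , refl
  ... | no ne = ⊥-elim (disjoint-elim (lookup-disjoint x (disjoint F) i i' ne) (hs i)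
                  (subst (_∈ lookup x i') (sym (SP.x∈⁅y⁆⇒x≡y (sx i') (subst (sx i ∈_) e (SP.x∈⁅x⁆ (sx i))))) (hs i')))

-- Linear independence
coeff-absent : (c : Chain n) (τ : List (Subset n)) → All (λ t → sortV (proj₂ t) ≢ τ) c → coeff c τ ≡ + 0
coeff-absent [] τ [] = refl
coeff-absent ((a , v) ∷ c) τ (h ∷ hs) = trans (coeff-cons a v c τ) (cong₂ _+_ (termCoeff-≢ a v τ h) (coeff-absent c τ hs))

anyᵇ-deleteV : (f : Subset n → Bool) (x : Subset n) (τ : List (Subset n)) → anyᵇ f τ ≡ false → anyᵇ f (deleteV x τ) ≡ false
anyᵇ-deleteV f x [] h = refl
anyᵇ-deleteV f x (y ∷ τ) h with x ≟S y
... | yes _ = BP.∨-conicalʳ (f y) _ h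
... | no _ = trans (cong (f y ∨_) (anyᵇ-deleteV f x τ (BP.∨-conicalʳ (f y) _ h))) (trans (cong (_∨ false) (BP.∨-conicalˡ (f y) _ h)) refl)

isOne : ℕ → Bool
isOne (suc zero) = true
isOne _ = false

isSingleton : Subset n → Bool
isSingleton V = isOne ∣ V ∣

isSingleton-⁅x⁆ : (t : Fin n) → isSingleton ⁅ t ⁆ ≡ true
isSingleton-⁅x⁆ t rewrite SP.∣⁅x⁆∣≡1 t = refl

isSingleton-big : (V : Subset n) → 2 ≤ ∣ V ∣ → isSingleton V ≡ false
isSingleton-big V h with ∣ V ∣
isSingleton-big V (s≤s (s≤s _)) | suc (suc k) = refl

T⇒≡ : ∀ {b} → T b → b ≡ true
T⇒≡ {true} _ = refl

StrictlySorted : List (Subset n) → Set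
StrictlySorted = Linked (λ p q → T (ltS p q))

sortV-strictlySorted : (l : List (Subset n)) → StrictlySorted l → (sortV l ≡ l) × (sortSign l ≡ + 1)
sortV-strictlySorted [] _ = refl , refl
sortV-strictlySorted (x ∷ []) _ = refl , refl
sortV-strictlySorted (x ∷ e ∷ l) (r ∷ rs) with sortV-strictlySorted (e ∷ l) rs
... | e1 , e2 rewrite e1 | e2 | ltS-asym x e (T⇒≡ r) = refl , refl

coeff-join-absent : (f : Subset n → Bool) (x : Subset n) → f x ≡ true → (c : Chain n) (τ : List (Subset n)) →
  anyᵇ f τ ≡ false → coeff (join x c) τ ≡ + 0
coeff-join-absent f x fx c τ h = coeff-absent (join x c) τ (go c)
  where
  go : ∀ c → All (λ t → sortV (proj₂ t) ≢ τ) (join x c)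
  go [] = []
  go ((a , w) ∷ c) = (λ e → true≢false (trans (sym h') (trans (cong (anyᵇ f) e) h))) ∷ go c
    where
    h' : anyᵇ f (sortV (x ∷ w)) ≡ true
    h' = trans (anyᵇ-sortV f (x ∷ w)) (cong (_∨ anyᵇ f w) fx)

-- Apart from the face of all blocks, every face of crossCycle ps contains a singleton pole {t}.
crossCycle-coeff-noSingleton : (ps : List (Subset n × Fin n)) (τ : List (Subset n)) → anyᵇ isSingleton τ ≡ false →
  coeff (crossCycle ps) τ ≡ coeff ((+ 1 , map proj₁ ps) ∷ []) τ
crossCycle-coeff-noSingleton [] τ h = refl
crossCycle-coeff-noSingleton ((B , t) ∷ ps) τ h =
  trans (coeff-++ (join B (crossCycle ps)) _ τ)
   (trans (cong₂ _+_ (coeff-join B (crossCycle ps) τ) (trans (coeff-neg (join ⁅ t ⁆ (crossCycle ps)) τ) (cong -_ (coeff-join-absent isSingleton ⁅ t ⁆ (isSingleton-⁅x⁆ t) (crossCycle ps) τ h))))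
     (trans (ZP.+-identityʳ _)
       (trans (cong (joinCoeff B τ) (crossCycle-coeff-noSingleton ps (deleteV B τ) (anyᵇ-deleteV isSingleton B τ h)))
         (sym (coeff-join B ((+ 1 , map proj₁ ps) ∷ []) τ)))))

MissesVertexOf : List (Subset n) → List (Subset n) → Set
MissesVertexOf {n} v w = Σ (Subset n) λ x → Any (x ≡_) v × Nonempty x × All (Disjoint x) w

All-disjoint-Any : {y x : Subset n} {l : List (Subset n)} → All (Disjoint y) l → Any (x ≡_) l → Disjoint y x
All-disjoint-Any (d ∷ ds) (here refl) = d
All-disjoint-Any (d ∷ ds) (there a) = All-disjoint-Any ds a

∂term-misses : (a : ℤ) (v : List (Subset n)) → IsFace v → All (λ t → MissesVertexOf v (proj₂ t)) (∂term a v)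
∂term-misses a [] _ = []
∂term-misses a (y ∷ ys) (ne ∷ nes , d ∷ ds) =
  (y , here refl , ne , d) ∷ join-All y (∂term (- a) ys) (All.map f (∂term-misses (- a) ys (nes , ds)))
  where
  f : ∀ {w} → MissesVertexOf ys w → MissesVertexOf (y ∷ ys) (y ∷ w)
  f (x , m , nx , dx) = x , there m , nx , disjoint-sym (All-disjoint-Any d m) ∷ dx

∂-misses : ∀ {k} (b : Chain n) → IsChainOf k b → All (λ t → Σ (List (Subset n)) λ v → IsFace v × MissesVertexOf v (proj₂ t)) (∂ b)
∂-misses [] [] = []
∂-misses ((a , v) ∷ b) ((_ , fv) ∷ hs) = AllP.++⁺ (All.map (λ m → v , fv , m) (∂term-misses a v fv)) (∂-misses b hs)

hasElem : Fin n → Subset n → Bool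
hasElem a V = isYes (a SP.∈? V)

∈⇒hasElem : (a : Fin n) (V : Subset n) → a ∈ V → hasElem a V ≡ true
∈⇒hasElem a V m with a SP.∈? V
... | yes _ = refl
... | no nm = ⊥-elim (nm m)

hasElem⇒∈ : (a : Fin n) (V : Subset n) → hasElem a V ≡ true → a ∈ V
hasElem⇒∈ a V h with a SP.∈? V
... | yes m = m

Any⇒anyᵇ : (a : Fin n) (l : List (Subset n)) → Any (a ∈_) l → anyᵇ (hasElem a) l ≡ true
Any⇒anyᵇ a (V ∷ l) (here m) rewrite ∈⇒hasElem a V m = refl
Any⇒anyᵇ a (V ∷ l) (there m) rewrite Any⇒anyᵇ a l m = BP.∨-zeroʳ (hasElem a V)

anyᵇ⇒Any : (a : Fin n) (l : List (Subset n)) → anyᵇ (hasElem a) l ≡ true → Any (a ∈_) l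
anyᵇ⇒Any a (V ∷ l) h with hasElem a V in e
... | true = here (hasElem⇒∈ a V e)
... | false = there (anyᵇ⇒Any a l h)

All-disjoint-Any-⊥ : ∀ {a : Fin n} {x : Subset n} {w} → a ∈ x → All (Disjoint x) w → Any (a ∈_) w → ⊥
All-disjoint-Any-⊥ ax (d ∷ ds) (here m) = disjoint-elim d ax m
All-disjoint-Any-⊥ ax (d ∷ ds) (there m) = All-disjoint-Any-⊥ ax ds m

-- A face of ∂ b misses a nonempty vertex of a face of b, which is disjoint from it, so it does not cover [n].
coeff-∂-covering : ∀ {k} (b : Chain n) → IsChainOf k b → (τ : List (Subset n)) → (∀ (a : Fin n) → Any (a ∈_) τ) →
  coeff (∂ b) τ ≡ + 0
coeff-∂-covering {k = k} b hb τ cov = coeff-absent (∂ b) τ (All.map (λ {t} → g {t}) (∂-misses {k = k} b hb))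
  where
  g : ∀ {t : Term _} → (Σ (List (Subset _)) λ v → IsFace v × MissesVertexOf v (proj₂ t)) → sortV (proj₂ t) ≢ τ
  g {a , w} (v , fv , x , _ , (a0 , ax) , dx) e =
    All-disjoint-Any-⊥ ax dx (anyᵇ⇒Any a0 w (trans (sym (anyᵇ-sortV (hasElem a0) w)) (trans (cong (anyᵇ (hasElem a0)) e) (Any⇒anyᵇ a0 τ (cov a0)))))

blockPairs-blocks : ∀ {j} (x : Vec (Subset n) j) (s : Fin j → Fin n) → map proj₁ (blockPairs x s) ≡ toList x
blockPairs-blocks Vec.[] s = refl
blockPairs-blocks (x Vec.∷ xs) s = cong (x ∷_) (blockPairs-blocks xs _)

noSingleton-blocks : ∀ {j} (x : Vec (Subset n) j) → (∀ i → 2 ≤ ∣ lookup x i ∣) → anyᵇ isSingleton (toList x) ≡ false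
noSingleton-blocks Vec.[] h = refl
noSingleton-blocks (x Vec.∷ xs) h rewrite isSingleton-big x (h zero) = noSingleton-blocks xs (λ i → h (suc i))

σ : ∀ {j} → (Vec (Subset n) j → Fin j → Fin n) → NSPart n j → Chain n
σ s F = sigma (blocks F) (s (blocks F))

facet : ∀ {j} → NSPart n j → List (Subset n)
facet F = toList (blocks F)

coeff-sigma-facet : ∀ {j} (s : Vec (Subset n) j → Fin j → Fin n) (G F : NSPart n j) →
  coeff (σ s G) (facet F) ≡ termCoeff (+ 1) (facet G) (facet F)
coeff-sigma-facet s G F = begin
  coeff (σ s G) (facet F)
    ≡⟨ cong (λ c → coeff c (facet F)) (sigma≡crossCycle (blocks G) (s (blocks G))) ⟩
  coeff (crossCycle ps) (facet F)
    ≡⟨ crossCycle-coeff-noSingleton ps (facet F) (noSingleton-blocks (blocks F) (big F)) ⟩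
  coeff ((+ 1 , map proj₁ ps) ∷ []) (facet F)
    ≡⟨ trans (coeff-cons (+ 1) (map proj₁ ps) [] (facet F)) (ZP.+-identityʳ _) ⟩
  termCoeff (+ 1) (map proj₁ ps) (facet F)
    ≡⟨ cong (λ l → termCoeff (+ 1) l (facet F)) (blockPairs-blocks (blocks G) (s (blocks G))) ⟩
  termCoeff (+ 1) (facet G) (facet F) ∎
  where
  open ≡-Reasoning
  ps = blockPairs (blocks G) (s (blocks G))

coeff-sigma-ownFacet : ∀ {j} (s : Vec (Subset n) j → Fin j → Fin n) (F : NSPart n j) → coeff (σ s F) (facet F) ≡ + 1
coeff-sigma-ownFacet s F =
  trans (coeff-sigma-facet s F F) (trans (termCoeff-≡ (+ 1) (facet F) (facet F) (proj₁ ss)) (cong (_* + 1) (proj₂ ss)))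
  where
  ss = sortV-strictlySorted (facet F) (sorted F)

coeff-sigma-otherFacet : ∀ {j} (s : Vec (Subset n) j → Fin j → Fin n) (G F : NSPart n j) → blocks G ≢ blocks F →
  coeff (σ s G) (facet F) ≡ + 0
coeff-sigma-otherFacet s G F G≢F =
  trans (coeff-sigma-facet s G F) (termCoeff-≢ (+ 1) (facet G) (facet F) (λ e → G≢F (toList-injective′ (blocks G) (blocks F)
    (trans (sym (proj₁ (sortV-strictlySorted (facet G) (sorted G)))) e))))
  where
  toList-injective′ : ∀ {A : Set} {m} (xs ys : Vec A m) → toList xs ≡ toList ys → xs ≡ ys
  toList-injective′ xs ys e = trans (sym (VP.cast-is-id refl xs)) (VP.toList-injective refl xs ys e)

module _ {n j : ℕ} (s : Vec (Subset n) j → Fin j → Fin n) where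

  coeff-comb-∷ : (μ : ℤ) (G : NSPart n j) (L : List (ℤ × NSPart n j)) (τ : List (Subset n)) →
    coeff (comb s ((μ , G) ∷ L)) τ ≡ μ * coeff (σ s G) τ + coeff (comb s L) τ
  coeff-comb-∷ μ G L τ = trans (coeff-++ (scale μ (σ s G)) (comb s L) τ) (cong (_+ coeff (comb s L) τ) (coeff-scale μ (σ s G) τ))

  coeff-comb-otherFacets : (F : NSPart n j) (L : List (ℤ × NSPart n j)) → All (λ q → blocks (proj₂ q) ≢ blocks F) L →
    coeff (comb s L) (facet F) ≡ + 0
  coeff-comb-otherFacets F [] [] = refl
  coeff-comb-otherFacets F ((μ , G) ∷ L) (G≢F ∷ hs) = begin
    coeff (comb s ((μ , G) ∷ L)) (facet F)                  ≡⟨ coeff-comb-∷ μ G L (facet F) ⟩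
    μ * coeff (σ s G) (facet F) + coeff (comb s L) (facet F)
      ≡⟨ cong₂ (λ a b → μ * a + b) (coeff-sigma-otherFacet s G F G≢F) (coeff-comb-otherFacets F L hs) ⟩
    μ * + 0 + + 0                                            ≡⟨ cong (_+ + 0) (ZP.*-zeroʳ μ) ⟩
    + 0                                                      ∎
    where open ≡-Reasoning

  comb-independent : ∀ (L : List (ℤ × NSPart n j)) →
        AllPairs (λ p q → blocks (proj₂ p) ≢ blocks (proj₂ q)) L →
        ∀ (b : Chain n) → IsChainOf (suc j) b → comb s L ≈ ∂ b →
        All (λ p → proj₁ p ≡ + 0) L
  comb-independent [] [] b hb e = []
  comb-independent ((λ₀ , F) ∷ L) (F≢L ∷ hs) b hb e = λ₀≡0 ∷ comb-independent L hs b hb e′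
    where
    open ≡-Reasoning
    λ₀≡0 : λ₀ ≡ + 0
    λ₀≡0 = begin
      λ₀                                                        ≡⟨ sym (ZP.*-identityʳ λ₀) ⟩
      λ₀ * + 1                                                  ≡⟨ sym (ZP.+-identityʳ _) ⟩
      λ₀ * + 1 + + 0
        ≡⟨ sym (cong₂ (λ a b → λ₀ * a + b) (coeff-sigma-ownFacet s F)
                 (coeff-comb-otherFacets F L (All.map (λ ne e → ne (sym e)) F≢L))) ⟩
      λ₀ * coeff (σ s F) (facet F) + coeff (comb s L) (facet F) ≡⟨ sym (coeff-comb-∷ λ₀ F L (facet F)) ⟩
      coeff (comb s ((λ₀ , F) ∷ L)) (facet F)                  ≡⟨ e (facet F) ⟩
      coeff (∂ b) (facet F)                                     ≡⟨ coeff-∂-covering b hb (facet F) (covers F) ⟩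
      + 0                                                       ∎
    e′ : comb s L ≈ ∂ b
    e′ τ = begin
      coeff (comb s L) τ                                       ≡⟨ sym (ZP.+-identityˡ _) ⟩
      + 0 + coeff (comb s L) τ                                 ≡⟨ cong (λ a → a * coeff (σ s F) τ + coeff (comb s L) τ) (sym λ₀≡0) ⟩
      λ₀ * coeff (σ s F) τ + coeff (comb s L) τ                 ≡⟨ sym (coeff-comb-∷ λ₀ F L τ) ⟩
      coeff (comb s ((λ₀ , F) ∷ L)) τ                          ≡⟨ e τ ⟩
      coeff (∂ b) τ                                             ∎

eqSubset : Subset n → Subset n → Bool
eqSubset V W = isYes (V ≟S W)

eqSubset-refl : (V : Subset n) → eqSubset V V ≡ true
eqSubset-refl V with V ≟S V
... | yes _ = refl
... | no ne = ⊥-elim (ne refl)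

eqSubset⇒≡ : (V W : Subset n) → eqSubset V W ≡ true → V ≡ W
eqSubset⇒≡ V W h with V ≟S W
... | yes e = e

eqSubset-false⇒≢ : (V W : Subset n) → eqSubset V W ≡ false → V ≢ W
eqSubset-false⇒≢ V W h e with V ≟S W
... | no ne = ne e

≢⇒eqSubset-false : (V W : Subset n) → V ≢ W → eqSubset V W ≡ false
≢⇒eqSubset-false V W ne with V ≟S W
... | yes e = ⊥-elim (ne e)
... | no _ = refl

anyᵇ-false⇒All : (f : Subset n → Bool) (l : List (Subset n)) → anyᵇ f l ≡ false → All (λ W → f W ≡ false) l
anyᵇ-false⇒All f [] h = []
anyᵇ-false⇒All f (x ∷ l) h = BP.∨-conicalˡ (f x) _ h ∷ anyᵇ-false⇒All f l (BP.∨-conicalʳ (f x) _ h)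

All⇒anyᵇ-false : (f : Subset n → Bool) (l : List (Subset n)) → All (λ W → f W ≡ false) l → anyᵇ f l ≡ false
All⇒anyᵇ-false f [] [] = refl
All⇒anyᵇ-false f (x ∷ l) (h ∷ hs) rewrite h = All⇒anyᵇ-false f l hs

anyᵇ-split : (f : Subset n → Bool) (τ : List (Subset n)) → anyᵇ f τ ≡ true →
  Σ (List (Subset n)) λ α → Σ (Subset n) λ V → Σ (List (Subset n)) λ β →
    (τ ≡ α ++ V ∷ β) × (f V ≡ true) × (anyᵇ f α ≡ false)
anyᵇ-split f (x ∷ τ) h with f x in fx
... | true = [] , x , τ , refl , fx , refl
... | false with anyᵇ-split f τ h
...   | α , V , β , e , fv , fa = x ∷ α , V , β , cong (x ∷_) e , fv , trans (cong (_∨ anyᵇ f α) fx) fa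

negateTimes : ℕ → ℤ → ℤ
negateTimes zero a = a
negateTimes (suc k) a = negateTimes k (- a)

negateTimes≡negOnePow* : (k : ℕ) (a : ℤ) → negateTimes k a ≡ negOnePow k * a
negateTimes≡negOnePow* zero a = sym (ZP.*-identityˡ a)
negateTimes≡negOnePow* (suc k) a = trans (negateTimes≡negOnePow* k (- a)) (nl (negOnePow k) a)
  where
  nl : ∀ p a → p * - a ≡ (- p) * a
  nl = solve-∀

-- When V is a vertex of τ, a τ ≈ join V (linkTerm V a τ): the sign records moving V to the front.
linkTerm : Subset n → ℤ → List (Subset n) → Chain n
linkTerm V a [] = []
linkTerm V a (x ∷ r) with x ≟S V
... | yes _ = (a , r) ∷ []
... | no _ = join x (linkTerm V (- a) r)

linkTerm-present : (α : List (Subset n)) (V : Subset n) (β : List (Subset n)) (a : ℤ) → anyᵇ (eqSubset V) α ≡ false →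
  linkTerm V a (α ++ V ∷ β) ≡ (negateTimes (length α) a , α ++ β) ∷ []
linkTerm-present [] V β a h with V ≟S V
... | yes _ = refl
... | no ne = ⊥-elim (ne refl)
linkTerm-present (x ∷ α) V β a h with x ≟S V
... | yes e = ⊥-elim (eqSubset-false⇒≢ V x (BP.∨-conicalˡ (eqSubset V x) _ h) (sym e))
... | no _ rewrite linkTerm-present α V β (- a) (BP.∨-conicalʳ (eqSubset V x) _ h) = refl

linkTerm-absent : (V : Subset n) (a : ℤ) (τ : List (Subset n)) → anyᵇ (eqSubset V) τ ≡ false → linkTerm V a τ ≡ []
linkTerm-absent V a [] h = refl
linkTerm-absent V a (x ∷ τ) h with x ≟S V
... | yes e = ⊥-elim (eqSubset-false⇒≢ V x (BP.∨-conicalˡ (eqSubset V x) _ h) (sym e))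
... | no _ rewrite linkTerm-absent V (- a) τ (BP.∨-conicalʳ (eqSubset V x) _ h) = refl

singleton-≋ : (a b : ℤ) (v w : List (Subset n)) → (∀ τ → termCoeff a v τ ≡ termCoeff b w τ) → ((a , v) ∷ []) ≋ ((b , w) ∷ [])
singleton-≋ a b v w h = ⟨ (λ τ → trans (coeff-cons a v [] τ) (trans (cong (_+ + 0) (h τ)) (sym (coeff-cons b w [] τ)))) ⟩

term-moveToFront : (α : List (Subset n)) (V : Subset n) (β : List (Subset n)) (a : ℤ) → anyᵇ (eqSubset V) α ≡ false →
  ((a , α ++ V ∷ β) ∷ []) ≋ ((negOnePow (length α) * a , V ∷ α ++ β) ∷ [])
term-moveToFront α V β a h = singleton-≋ a _ (α ++ V ∷ β) (V ∷ α ++ β) (termCoeff-cong a _ (α ++ V ∷ β) (V ∷ α ++ β) (proj₁ m)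
    (trans (cong (_* a) (proj₂ m)) (sa (negOnePow (length α)) (sortSign (V ∷ α ++ β)) a)))
  where
  m = sortV-moveToFront α V β (All.map (λ {W} e → λ eq → eqSubset-false⇒≢ V W e eq) (anyᵇ-false⇒All (eqSubset V) α h))
  sa : ∀ p s a → (p * s) * a ≡ s * (p * a)
  sa = solve-∀

∂term-anyᵇ : (f : Subset n → Bool) (a : ℤ) (τ : List (Subset n)) → anyᵇ f τ ≡ false →
  All (λ t → anyᵇ f (proj₂ t) ≡ false) (∂term a τ)
∂term-anyᵇ f a [] h = []
∂term-anyᵇ f a (x ∷ τ) h = BP.∨-conicalʳ (f x) _ h ∷ join-All x (∂term (- a) τ)
  (All.map (λ {t} → g {t}) (∂term-anyᵇ f (- a) τ (BP.∨-conicalʳ (f x) _ h)))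
  where
  g : ∀ {t : Term _} → anyᵇ f (proj₂ t) ≡ false → anyᵇ f (x ∷ proj₂ t) ≡ false
  g {t} e = trans (cong (_∨ anyᵇ f (proj₂ t)) (BP.∨-conicalˡ (f x) _ h)) e

filterChain-drop : (p : List (Subset n) → Bool) (a : ℤ) (v : List (Subset n)) (c : Chain n) → p v ≡ false → filterChain p ((a , v) ∷ c) ≡ filterChain p c
filterChain-drop p a v c h rewrite h = refl

filterChain-keep : (p : List (Subset n) → Bool) (a : ℤ) (v : List (Subset n)) (c : Chain n) → p v ≡ true → filterChain p ((a , v) ∷ c) ≡ (a , v) ∷ filterChain p c
filterChain-keep p a v c h rewrite h = refl

avoids : Fin n → List (Subset n) → Bool
avoids u w = not (anyᵇ (hasElem u) w)

avoids-sortInvariant : (u : Fin n) → SortInvariant (avoids u)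
avoids-sortInvariant u v = cong not (anyᵇ-sortV (hasElem u) v)

elemᵇ : Subset n → List (Subset n) → Bool
elemᵇ V w = anyᵇ (eqSubset V) w

elemᵇ-sortInvariant : (V : Subset n) → SortInvariant (elemᵇ V)
elemᵇ-sortInvariant V v = anyᵇ-sortV (eqSubset V) v

filterAvoids-∂term : (u : Fin n) (α : List (Subset n)) (V0 : Subset n) (β : List (Subset n)) (a : ℤ) →
  hasElem u V0 ≡ true → anyᵇ (hasElem u) α ≡ false → anyᵇ (hasElem u) β ≡ false →
  filterChain (avoids u) (∂term a (α ++ V0 ∷ β)) ≡ linkTerm V0 a (α ++ V0 ∷ β)
filterAvoids-∂term u [] V0 β a hv hα hβ with V0 ≟S V0
... | no ne = ⊥-elim (ne refl)
... | yes _ rewrite hβ = cong ((a , β) ∷_) (filterChain-none (avoids u) (join V0 (∂term (- a) β)) (join-All V0 _ (allF (∂term (- a) β))))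
  where
  allF : ∀ (c : Chain _) → All (λ t → avoids u (V0 ∷ proj₂ t) ≡ false) c
  allF [] = []
  allF (t ∷ c) = cong not (cong (_∨ _) hv) ∷ allF c
filterAvoids-∂term u (y ∷ α) V0 β a hv hα hβ with y ≟S V0
... | yes e = ⊥-elim (true≢false (trans (sym (trans (cong (hasElem u) e) hv)) (BP.∨-conicalˡ (hasElem u y) _ hα)))
... | no _ = trans (filterChain-drop (avoids u) a (α ++ V0 ∷ β) (join y (∂term (- a) (α ++ V0 ∷ β))) cov) (trans (filterChain-join (avoids u) y (λ w → cong (λ b → not (b ∨ anyᵇ (hasElem u) w)) (BP.∨-conicalˡ (hasElem u y) _ hα)) (∂term (- a) (α ++ V0 ∷ β)))
        (cong (join y) (filterAvoids-∂term u α V0 β (- a) hv (BP.∨-conicalʳ (hasElem u y) _ hα) hβ)))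
  where
  cov : avoids u (α ++ V0 ∷ β) ≡ false
  cov = cong not (trans (anyᵇ-++ (hasElem u) α (V0 ∷ β)) (trans (cong (anyᵇ (hasElem u) α ∨_) (cong (_∨ _) hv)) (BP.∨-zeroʳ _)))

filterElem-∂term : (α : List (Subset n)) (V : Subset n) (β : List (Subset n)) (a : ℤ) →
  anyᵇ (eqSubset V) α ≡ false → anyᵇ (eqSubset V) β ≡ false →
  filterChain (elemᵇ V) (∂term a (α ++ V ∷ β)) ≋ negChain (join V (∂ (linkTerm V a (α ++ V ∷ β))))
filterElem-∂term [] V β a hα hβ with V ≟S V
... | no ne = ⊥-elim (ne refl)
... | yes _ = ≡⇒≋ (trans (filterChain-drop (elemᵇ V) a β (join V (∂term (- a) β)) hβ)
    (trans (filterChain-all (elemᵇ V) (join V (∂term (- a) β)) (join-All V _ (allT (∂term (- a) β))))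
      (trans (cong (join V) (∂term-neg a β)) (trans (join-negChain V (∂term a β)) (cong (λ c → negChain (join V c)) (sym (LP.++-identityʳ (∂term a β))))))))
  where
  allT : ∀ (c : Chain _) → All (λ t → elemᵇ V (V ∷ proj₂ t) ≡ true) c
  allT [] = []
  allT (t ∷ c) = cong (_∨ anyᵇ (eqSubset V) (proj₂ t)) (eqSubset-refl V) ∷ allT c
filterElem-∂term (y ∷ α) V β a hα hβ with y ≟S V
... | yes e = ⊥-elim (eqSubset-false⇒≢ V y (BP.∨-conicalˡ (eqSubset V y) _ hα) (sym e))
... | no ne =
  ≋-trans (≡⇒≋ (trans (filterChain-keep (elemᵇ V) a ρ (join y (∂term (- a) ρ)) memρ)
                 (cong ((a , ρ) ∷_) (filterChain-join (elemᵇ V) y (λ w → cong (_∨ anyᵇ (eqSubset V) w) (≢⇒eqSubset-false V y (λ e → ne (sym e)))) (∂term (- a) ρ)))))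
  (≋-trans (∷-cong-≋ (a , ρ) (join-cong y (filterElem-∂term α V β (- a) hα' hβ)))
  (≋-trans (++-cong {c = (a , ρ) ∷ []} headEq tailEq)
  (≋-trans (≡⇒≋ (sym (negChain-++ (join V Y') _)))
  (≋-trans (≡⇒≋ (cong negChain (sym (join-++ V Y' (negChain (join y (∂ Y')))))))
  (negChain-cong (join-cong V (≋-sym (∂-join y Y'))))))))
  where
  ρ = α ++ V ∷ β
  hα' = BP.∨-conicalʳ (eqSubset V y) _ hα
  memρ : elemᵇ V ρ ≡ true
  memρ = trans (anyᵇ-++ (eqSubset V) α (V ∷ β)) (trans (cong (anyᵇ (eqSubset V) α ∨_) (cong (_∨ anyᵇ (eqSubset V) β) (eqSubset-refl V))) (BP.∨-zeroʳ _))
  Y' = linkTerm V (- a) ρ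
  W = ∂ Y'
  k = length α
  alg : ∀ (p a : ℤ) → - (p * - a) ≡ p * a
  alg = solve-∀
  headEq : ((a , ρ) ∷ []) ≋ negChain (join V Y')
  headEq = ≋-trans (term-moveToFront α V β a hα')
    (≡⇒≋ (trans (cong (λ c → (c , V ∷ α ++ β) ∷ []) (sym (trans (cong -_ (negateTimes≡negOnePow* k (- a))) (alg (negOnePow k) a))))
                (cong (λ c → negChain (join V c)) (sym (linkTerm-present α V β (- a) hα')))))
  tailEq : join y (negChain (join V W)) ≋ negChain (join V (negChain (join y W)))
  tailEq = ≋-trans (≡⇒≋ (join-negChain y (join V W)))
    (≋-trans (negChain-cong (join-swap y V (λ e → ne e) W))
      (≡⇒≋ (cong negChain (sym (join-negChain V (join y W))))))

concatMap-cong-≋ : ∀ {A : Set} (f g : A → Chain n) → (∀ x → f x ≋ g x) → (l : List A) → concatMap f l ≋ concatMap g l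
concatMap-cong-≋ f g h [] = ≋-refl
concatMap-cong-≋ f g h (x ∷ l) = ++-cong (h x) (concatMap-cong-≋ f g h l)

concatMap-++-≋ : ∀ {A : Set} (f g : A → Chain n) (l : List A) →
  concatMap (λ x → f x ++ g x) l ≋ (concatMap f l ++ concatMap g l)
concatMap-++-≋ f g [] = ≋-refl
concatMap-++-≋ f g (x ∷ l) =
  ≋-trans (++-congʳ (f x ++ g x) (concatMap-++-≋ f g l))
   (≋-trans (++-assoc-≋ (f x) (g x) _)
    (≋-trans (++-congʳ (f x) (++-leftComm-≋ (g x) (concatMap f l) (concatMap g l)))
      (≋-sym (++-assoc-≋ (f x) (concatMap f l) _))))

concatMap-nil : ∀ {A : Set} (f : A → Chain n) (l : List A) → All (λ x → f x ≡ []) l → concatMap f l ≡ []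
concatMap-nil f [] [] = refl
concatMap-nil f (x ∷ l) (h ∷ hs) rewrite h = concatMap-nil f l hs

++-interchange₃-≋ : (A B C D E F : Chain n) →
  ((A ++ (B ++ C)) ++ (D ++ (E ++ F))) ≋ ((A ++ D) ++ ((B ++ E) ++ (C ++ F)))
++-interchange₃-≋ A B C D E F = ⟨ (λ τ → trans (ex τ) (trans (alg (coeff A τ) (coeff B τ) (coeff C τ) (coeff D τ) (coeff E τ) (coeff F τ)) (sym (ex' τ)))) ⟩
  where
  cf = coeff-++
  alg : ∀ a b c d e f → (a + (b + c)) + (d + (e + f)) ≡ (a + d) + ((b + e) + (c + f))
  alg = solve-∀
  ex : ∀ τ → coeff ((A ++ (B ++ C)) ++ (D ++ (E ++ F))) τ ≡ (coeff A τ + (coeff B τ + coeff C τ)) + (coeff D τ + (coeff E τ + coeff F τ))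
  ex τ = trans (cf (A ++ (B ++ C)) _ τ) (cong₂ _+_ (trans (cf A _ τ) (cong (_+_ (coeff A τ)) (cf B C τ))) (trans (cf D _ τ) (cong (_+_ (coeff D τ)) (cf E F τ))))
  ex' : ∀ τ → coeff ((A ++ D) ++ ((B ++ E) ++ (C ++ F))) τ ≡ (coeff A τ + coeff D τ) + ((coeff B τ + coeff E τ) + (coeff C τ + coeff F τ))
  ex' τ = trans (cf (A ++ D) _ τ) (cong₂ _+_ (cf A D τ) (trans (cf (B ++ E) _ τ) (cong₂ _+_ (cf B E τ) (cf C F τ))))

dedup : List (Subset n) → List (Subset n)
dedup [] = []
dedup (x ∷ l) = if elemᵇ x l then dedup l else x ∷ dedup l

dedup-All : ∀ {Q : Subset n → Set} (l : List (Subset n)) → All Q l → All Q (dedup l)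
dedup-All [] [] = []
dedup-All (x ∷ l) (q ∷ qs) with elemᵇ x l
... | true = dedup-All l qs
... | false = q ∷ dedup-All l qs

elemᵇ⇒Any : (V : Subset n) (l : List (Subset n)) → elemᵇ V l ≡ true → Any (V ≡_) l
elemᵇ⇒Any V (x ∷ l) h with eqSubset V x in e
... | true = here (eqSubset⇒≡ V x e)
... | false = there (elemᵇ⇒Any V l h)

Any⇒elemᵇ : (V : Subset n) (l : List (Subset n)) → Any (V ≡_) l → elemᵇ V l ≡ true
Any⇒elemᵇ V (x ∷ l) (here refl) rewrite eqSubset-refl V = refl
Any⇒elemᵇ V (x ∷ l) (there a) rewrite Any⇒elemᵇ V l a = BP.∨-zeroʳ _

CountsOnce : (Subset n → Set) → Subset n → List (Subset n) → Set
CountsOnce {n} Q V0 Ws = ∀ (f : Subset n → Chain n) → (∀ V → Q V → V ≢ V0 → f V ≡ []) → concatMap f Ws ≋ f V0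

dedup-countsOnce : ∀ {Q : Subset n → Set} (V0 : Subset n) (l : List (Subset n)) → All Q l → Any (V0 ≡_) l → CountsOnce Q V0 (dedup l)
dedup-countsOnce V0 (x ∷ l) (q ∷ qs) a f hf with elemᵇ x l in mx
dedup-countsOnce V0 (x ∷ l) (q ∷ qs) (here refl) f hf | true = dedup-countsOnce V0 l qs (elemᵇ⇒Any V0 l mx) f hf
dedup-countsOnce V0 (x ∷ l) (q ∷ qs) (there a) f hf | true = dedup-countsOnce V0 l qs a f hf
dedup-countsOnce {Q = Q} V0 (x ∷ l) (q ∷ qs) (here refl) f hf | false =
  ≋-trans (≡⇒≋ (cong (f V0 ++_) (concatMap-nil f (dedup l) (dedup-All l (notin l qs mx))))) (++-identityʳ-≋ (f V0))
  where
  notin : ∀ l → All Q l → elemᵇ V0 l ≡ false → All (λ V → f V ≡ []) l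
  notin [] [] _ = []
  notin (y ∷ l) (q ∷ qs) h = hf y q (λ e → eqSubset-false⇒≢ V0 y (BP.∨-conicalˡ (eqSubset V0 y) _ h) (sym e)) ∷ notin l qs (BP.∨-conicalʳ (eqSubset V0 y) _ h)
dedup-countsOnce V0 (x ∷ l) (q ∷ qs) (there a) f hf | false with x ≟S V0
... | yes refl = ⊥-elim (true≢false (trans (sym (Any⇒elemᵇ x l a)) mx))
... | no ne = ≋-trans (≡⇒≋ (cong (_++ concatMap f (dedup l)) (hf x q ne))) (dedup-countsOnce V0 l qs a f hf)

elemᵇ-false : (f : Subset n → Bool) (V : Subset n) (τ : List (Subset n)) → anyᵇ f τ ≡ false → f V ≡ true → elemᵇ V τ ≡ false
elemᵇ-false f V [] h fv = refl
elemᵇ-false f V (x ∷ τ) h fv with V ≟S x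
... | yes refl = ⊥-elim (true≢false (trans (sym fv) (BP.∨-conicalˡ (f V) _ h)))
... | no _ = elemᵇ-false f V τ (BP.∨-conicalʳ (f x) _ h) fv

≢true⇒false : (b : Bool) → (b ≡ true → ⊥) → b ≡ false
≢true⇒false false _ = refl
≢true⇒false true h = ⊥-elim (h refl)

filterSubsets : (Subset n → Bool) → List (Subset n) → List (Subset n)
filterSubsets g [] = []
filterSubsets g (x ∷ l) = if g x then x ∷ filterSubsets g l else filterSubsets g l

module ConeAt {n : ℕ} (u : Fin n) where

  pole : Subset n
  pole = ⁅ u ⁆

  cone : Chain n → Chain n
  cone c = join pole (filterChain (avoids u) c)

  isLinkVertex : Subset n → Bool
  isLinkVertex V = hasElem u V ∧ not (eqSubset V pole)

  isLinkVertex⇒∋ : (V : Subset n) → isLinkVertex V ≡ true → hasElem u V ≡ true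
  isLinkVertex⇒∋ V g = BP.∧-conicalˡ (hasElem u V) _ g

  isLinkVertex⇒≢pole : (V : Subset n) → isLinkVertex V ≡ true → V ≢ pole
  isLinkVertex⇒≢pole V g = eqSubset-false⇒≢ V pole (not≡true⇒≡false (eqSubset V pole) (BP.∧-conicalʳ (hasElem u V) _ g))

  isLinkVertex-intro : (V : Subset n) → hasElem u V ≡ true → V ≢ pole → isLinkVertex V ≡ true
  isLinkVertex-intro V hu ne rewrite hu | ≢⇒eqSubset-false V pole ne = refl

  suspendedLinks : List (Subset n) → Term n → Chain n
  suspendedLinks Ws t = concatMap (λ V → suspend V u (linkTerm V (proj₁ t) (proj₂ t))) Ws

  anyMid : ∀ {A : Set} (α : List A) (V : A) (β : List A) → Any (V ≡_) (α ++ V ∷ β)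
  anyMid [] V β = here refl
  anyMid (x ∷ α) V β = there (anyMid α V β)

  cancelMid : (t : Term n) (X : Chain n) → (((t ∷ negChain X) ++ []) ++ (X ++ [])) ≋ (t ∷ [])
  cancelMid t X = ≋-trans (++-cong (++-identityʳ-≋ (t ∷ negChain X)) (++-identityʳ-≋ X))
    (∷-cong-≋ t (≋-trans (++-comm-≋ (negChain X) X) (++-negChain-≋[] X)))

  LinkVertices : List (Subset n) → Set
  LinkVertices Ws = All (λ V → isLinkVertex V ≡ true) Ws

  -- A face τ avoiding u is ∂({u} * τ) + {u} * ∂τ. A face through the block V0 ∋ u is V0 * lk, the cone
  -- of its boundary is {u} * lk, and adding the suspension (V0 − {u}) * lk (absent if V0 = {u}) gives it back.
  term-decomposition-avoiding : (Ws : List (Subset n)) → LinkVertices Ws → (a : ℤ) (τ : List (Subset n)) →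
    anyᵇ (hasElem u) τ ≡ false →
    ((a , τ) ∷ []) ≋ (∂ (join pole ((a , τ) ∷ [])) ++ (cone (∂term a τ) ++ suspendedLinks Ws (a , τ)))
  term-decomposition-avoiding Ws gW a τ e
    rewrite filterChain-all (avoids u) (∂term a τ) (All.map (cong not) (∂term-anyᵇ (hasElem u) a τ e))
          | concatMap-nil (λ V → suspend V u (linkTerm V a τ)) Ws
              (All.map (λ {V} g → cong (suspend V u) (linkTerm-absent V a τ (elemᵇ-false (hasElem u) V τ e (isLinkVertex⇒∋ V g)))) gW)
          | ∂term-neg a τ | join-negChain pole (∂term a τ) =
    ≋-sym (cancelMid (a , τ) (join pole (∂term a τ)))

  term-decomposition-through : (Ws : List (Subset n)) → LinkVertices Ws → (a : ℤ) (α : List (Subset n)) (V0 : Subset n) (β : List (Subset n)) →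
    IsFace (α ++ V0 ∷ β) → hasElem u V0 ≡ true → anyᵇ (hasElem u) α ≡ false →
    (isLinkVertex V0 ≡ true → CountsOnce (λ V → isLinkVertex V ≡ true) V0 Ws) →
    ((a , α ++ V0 ∷ β) ∷ []) ≋ (cone (∂term a (α ++ V0 ∷ β)) ++ suspendedLinks Ws (a , α ++ V0 ∷ β))
  term-decomposition-through Ws gW a α V0 β (_ , aps) hv hα once = ≋-sym (split (V0 ≟S pole))
    where
    τ = α ++ V0 ∷ β
    hβ : anyᵇ (hasElem u) β ≡ false
    hβ = All⇒anyᵇ-false (hasElem u) β (All.map (λ {W} d → ≢true⇒false (hasElem u W)
           (λ hw → disjoint-elim d (hasElem⇒∈ u V0 hv) (hasElem⇒∈ u W hw))) (proj₂ (AllPairs-middle α V0 β aps)))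
    V0∉α : elemᵇ V0 α ≡ false
    V0∉α = elemᵇ-false (hasElem u) V0 α hα hv
    Y = linkTerm V0 a τ
    cone≡ : cone (∂term a τ) ≡ join pole Y
    cone≡ = cong (join pole) (filterAvoids-∂term u α V0 β a hv hα hβ)
    V0*Y≋τ : join V0 Y ≋ ((a , τ) ∷ [])
    V0*Y≋τ = ≋-trans (≡⇒≋ (trans (cong (join V0) (linkTerm-present α V0 β a V0∉α))
                            (cong (λ c → (c , V0 ∷ α ++ β) ∷ []) (negateTimes≡negOnePow* (length α) a))))
                      (≋-sym (term-moveToFront α V0 β a V0∉α))
    others : ∀ V → isLinkVertex V ≡ true → V ≢ V0 → suspend V u (linkTerm V a τ) ≡ []
    others V g V≢V0 = cong (suspend V u) (linkTerm-absent V a τ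
      (trans (anyᵇ-++ (eqSubset V) α (V0 ∷ β))
        (cong₂ _∨_ (elemᵇ-false (hasElem u) V α hα (isLinkVertex⇒∋ V g))
                   (cong₂ _∨_ (≢⇒eqSubset-false V V0 V≢V0) (elemᵇ-false (hasElem u) V β hβ (isLinkVertex⇒∋ V g))))))
    split : Dec (V0 ≡ pole) → (cone (∂term a τ) ++ suspendedLinks Ws (a , τ)) ≋ ((a , τ) ∷ [])
    split (yes refl) rewrite cone≡
      | concatMap-nil (λ V → suspend V u (linkTerm V a τ)) Ws (All.map (λ {V} g → others V g (isLinkVertex⇒≢pole V g)) gW) =
      ≋-trans (++-identityʳ-≋ (join V0 Y)) V0*Y≋τ
    split (no V0≢pole) rewrite cone≡ =
      ≋-trans (++-congʳ (join pole Y) (once (isLinkVertex-intro V0 hv V0≢pole) (λ V → suspend V u (linkTerm V a τ)) others))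
        (≋-trans (++-leftComm-≋ (join pole Y) (join V0 Y) (negChain (join pole Y)))
          (≋-trans (++-≋[]ʳ (++-negChain-≋[] (join pole Y)) (join V0 Y)) V0*Y≋τ))

  term-decomposition : (Ws : List (Subset n)) → LinkVertices Ws → (a : ℤ) (τ : List (Subset n)) → IsFace τ →
    (∀ V0 → isLinkVertex V0 ≡ true → Any (V0 ≡_) τ → CountsOnce (λ V → isLinkVertex V ≡ true) V0 Ws) →
    ((a , τ) ∷ []) ≋ (∂ (cone ((a , τ) ∷ [])) ++ (cone (∂term a τ) ++ suspendedLinks Ws (a , τ)))
  term-decomposition Ws gW a τ fτ once with anyᵇ (hasElem u) τ in e
  ... | false = term-decomposition-avoiding Ws gW a τ e
  ... | true with anyᵇ-split (hasElem u) τ e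
  ...   | α , V0 , β , refl , hv , hα =
    term-decomposition-through Ws gW a α V0 β fτ hv hα (λ g → once V0 g (anyMid α V0 β))

  AllCountOnce : List (Subset n) → Chain n → Set
  AllCountOnce Ws z = All (λ t → ∀ V0 → isLinkVertex V0 ≡ true → Any (V0 ≡_) (proj₂ t) → CountsOnce (λ V → isLinkVertex V ≡ true) V0 Ws) z

  cone-++ : (c d : Chain n) → cone (c ++ d) ≡ cone c ++ cone d
  cone-++ c d = trans (cong (join pole) (filterChain-++ (avoids u) c d)) (join-++ pole (filterChain (avoids u) c) (filterChain (avoids u) d))

  chain-decomposition : (Ws : List (Subset n)) → LinkVertices Ws → (z : Chain n) →
    All (λ t → IsFace (proj₂ t)) z → AllCountOnce Ws z →
    z ≋ (∂ (cone z) ++ (cone (∂ z) ++ concatMap (suspendedLinks Ws) z))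
  chain-decomposition Ws gW [] [] [] = ≋-refl
  chain-decomposition Ws gW ((a , τ) ∷ z) (f ∷ fs) (o ∷ os) =
    ≋-trans (++-cong {c = (a , τ) ∷ []} (term-decomposition Ws gW a τ f o) (chain-decomposition Ws gW z fs os))
     (≋-trans (++-interchange₃-≋ (∂ (cone ((a , τ) ∷ []))) (cone (∂term a τ)) (suspendedLinks Ws (a , τ)) (∂ (cone z)) (cone (∂ z)) (concatMap (suspendedLinks Ws) z))
       (≡⇒≋ (sym (cong₂ _++_ (trans (cong ∂ (cone-++ ((a , τ) ∷ []) z)) (∂-++ (cone ((a , τ) ∷ [])) (cone z)))
                            (cong (_++ concatMap (suspendedLinks Ws) (((a , τ) ∷ z))) (cone-++ (∂term a τ) (∂ z)) )))))

  link : Subset n → Chain n → Chain n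
  link V z = concatMap (λ t → linkTerm V (proj₁ t) (proj₂ t)) z

  suspendedLinks-exchange : (Ws : List (Subset n)) (z : Chain n) →
    concatMap (suspendedLinks Ws) z ≋ concatMap (λ V → suspend V u (link V z)) Ws
  suspendedLinks-exchange Ws [] = ≡⇒≋ (sym (concatMap-nil (λ V → suspend V u []) Ws (allRefl Ws)))
    where
    allRefl : ∀ Ws → All (λ V → suspend V u [] ≡ []) Ws
    allRefl [] = []
    allRefl (V ∷ Ws) = refl ∷ allRefl Ws
  suspendedLinks-exchange Ws ((a , τ) ∷ z) =
    ≋-trans (++-congʳ (suspendedLinks Ws (a , τ)) (suspendedLinks-exchange Ws z))
      (≋-sym (≋-trans (concatMap-cong-≋ _ _ (λ V → suspend-++ V u (linkTerm V a τ) (link V z)) Ws)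
                      (concatMap-++-≋ (λ V → suspend V u (linkTerm V a τ)) (λ V → suspend V u (link V z)) Ws)))

  filterElem-∂term′ : (V : Subset n) (a : ℤ) (τ : List (Subset n)) → IsFace τ →
    filterChain (elemᵇ V) (∂term a τ) ≋ negChain (join V (∂ (linkTerm V a τ)))
  filterElem-∂term′ V a τ fτ with elemᵇ V τ in e
  ... | false rewrite linkTerm-absent V a τ e = ≡⇒≋ (filterChain-none (elemᵇ V) (∂term a τ) (∂term-anyᵇ (eqSubset V) a τ e))
  ... | true with anyᵇ-split (eqSubset V) τ e
  ...   | α , V' , β , refl , ev , hα with eqSubset⇒≡ V V' ev
  ...     | refl = filterElem-∂term α V β a hα hβ
    where
    hβ : elemᵇ V β ≡ false
    hβ = All⇒anyᵇ-false (eqSubset V) β (All.map (λ {W} d → ≢true⇒false (eqSubset V W)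
           (λ ew → let (x , xm) = All-middle α V β (proj₁ fτ) in disjoint-elim d xm (subst (x ∈_) (eqSubset⇒≡ V W ew) xm)))
           (proj₂ (AllPairs-middle α V β (proj₂ fτ))))

  filterElem-∂ : (V : Subset n) (z : Chain n) → All (λ t → IsFace (proj₂ t)) z →
    filterChain (elemᵇ V) (∂ z) ≋ negChain (join V (∂ (link V z)))
  filterElem-∂ V [] [] = ≋-refl
  filterElem-∂ V ((a , τ) ∷ z) (f ∷ fs) =
    ≋-trans (≡⇒≋ (filterChain-++ (elemᵇ V) (∂term a τ) (∂ z)))
     (≋-trans (++-cong (filterElem-∂term′ V a τ f) (filterElem-∂ V z fs))
       (≡⇒≋ (sym (trans (cong (λ c → negChain (join V c)) (∂-++ (linkTerm V a τ) (link V z)))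
                   (trans (cong negChain (join-++ V (∂ (linkTerm V a τ)) (∂ (link V z)))) (negChain-++ (join V (∂ (linkTerm V a τ))) _))))))

  ∂-link : (V : Subset n) (z : Chain n) → All (λ t → IsFace (proj₂ t)) z → ∂ z ≋ [] → ∂ (link V z) ≋ []
  ∂-link V z fs cz = join-≋[] V (≋-trans (≋-sym (negChain-involutive (join V (∂ (link V z)))))
    (negChain-cong {d = []} (≋-trans (≋-sym (filterElem-∂ V z fs)) (filterChain-cong (elemᵇ V) (elemᵇ-sortInvariant V) cz))))

-- Every cycle is a combination of iterated suspensions up to a boundary
FaceWithin : ℕ → Subset n → List (Subset n) → Set
FaceWithin k U v = (length v ≡ k × IsFace v) × All (_⊆ U) v

ChainWithin : ℕ → Subset n → Chain n → Set
ChainWithin k U c = All (λ t → FaceWithin k U (proj₂ t)) c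

linkTerm-within : ∀ {k} (U V : Subset n) (a : ℤ) (τ : List (Subset n)) → FaceWithin (suc k) U τ → ChainWithin k (U ∩ ∁ V) (linkTerm V a τ)
linkTerm-within U V a τ fi with elemᵇ V τ in e
... | false rewrite linkTerm-absent V a τ e = []
... | true with anyᵇ-split (eqSubset V) τ e
...   | α , V' , β , refl , ev , hα with eqSubset⇒≡ V V' ev
...     | refl rewrite linkTerm-present α V β a hα =
  ((length-dropMiddle α V β (proj₁ (proj₁ fi)) , All-dropMiddle α V β (proj₁ (proj₂ (proj₁ fi))) , AllPairs-dropMiddle α V β (proj₂ (proj₂ (proj₁ fi)))) ,
   All.zipWith {P = _⊆ U} {Q = Disjoint V} {R = _⊆ U ∩ ∁ V} (λ (W⊆U , V#W) → ⊆-∩∁ W⊆U V#W)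
     (All-dropMiddle α V β (proj₂ fi) , AllP.++⁺ (All.map disjoint-sym (proj₁ mid)) (proj₂ mid))) ∷ []
  where
  mid = AllPairs-middle α V β (proj₂ (proj₂ (proj₁ fi)))

link-within : ∀ {k} (u : Fin n) (U V : Subset n) (z : Chain n) → ChainWithin (suc k) U z → ChainWithin k (U ∩ ∁ V) (ConeAt.link u V z)
link-within u U V [] [] = []
link-within u U V ((a , τ) ∷ z) (f ∷ fs) = AllP.++⁺ (linkTerm-within U V a τ f) (link-within u U V z fs)

-- Blocks paired with their chosen points s_i, in any order.
Pairs : ℕ → Set
Pairs n = List (Subset n × Fin n)

combPairs : List (ℤ × Pairs n) → Chain n
combPairs L = concatMap (λ q → scale (proj₁ q) (crossCycle (proj₂ q))) L

IsPartitionBy : Subset n → Pairs n → Set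
IsPartitionBy U ps = All (λ p → (proj₂ p ∈ proj₁ p) × (proj₁ p ⊆ U) × (2 ≤ ∣ proj₁ p ∣)) ps
           × AllPairs (λ p q → Disjoint (proj₁ p) (proj₁ q)) ps
           × (∀ a → a ∈ U → Any (λ p → a ∈ proj₁ p) ps)

extendPairs : Subset n → Fin n → List (ℤ × Pairs n) → List (ℤ × Pairs n)
extendPairs V u L = map (λ q → (proj₁ q , (V , u) ∷ proj₂ q)) L

neg-scale : (a : ℤ) (c : Chain n) → negChain (scale a c) ≋ scale a (negChain c)
neg-scale a c = ⟨ (λ τ → trans (coeff-neg (scale a c) τ) (trans (cong -_ (coeff-scale a c τ))
   (trans (ZP.neg-distribʳ-* a (coeff c τ)) (trans (cong (a *_) (sym (coeff-neg c τ))) (sym (coeff-scale a (negChain c) τ)))))) ⟩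

scale-++ : (a : ℤ) (c d : Chain n) → scale a (c ++ d) ≡ scale a c ++ scale a d
scale-++ a c d = LP.map-++ _ c d

suspend-scale : (V : Subset n) (u : Fin n) (a : ℤ) (c : Chain n) → suspend V u (scale a c) ≋ scale a (suspend V u c)
suspend-scale V u a c rewrite join-scale V a c | join-scale ⁅ u ⁆ a c | scale-++ a (join V c) (negChain (join ⁅ u ⁆ c)) =
  ++-congʳ (scale a (join V c)) (neg-scale a (join ⁅ u ⁆ c))

suspend-combPairs : (V : Subset n) (u : Fin n) (L : List (ℤ × Pairs n)) → suspend V u (combPairs L) ≋ combPairs (extendPairs V u L)
suspend-combPairs V u [] = ≋-refl
suspend-combPairs V u ((a , ps) ∷ L) =
  ≋-trans (suspend-++ V u (scale a (crossCycle ps)) (combPairs L)) (++-cong (suspend-scale V u a (crossCycle ps)) (suspend-combPairs V u L))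

suspend-∂ : (V : Subset n) (u : Fin n) (b : Chain n) → suspend V u (∂ b) ≋ ∂ (negChain (suspend V u b))
suspend-∂ V u b = ≋-trans (≋-sym (negChain-involutive (suspend V u (∂ b))))
  (≋-trans (negChain-cong (≋-sym (∂-suspend V u b))) (≡⇒≋ (sym (∂-neg (suspend V u b)))))

big-nonSingleton : (u : Fin n) (V : Subset n) → u ∈ V → V ≢ ⁅ u ⁆ → 2 ≤ ∣ V ∣
big-nonSingleton u V uV ne with FP.any? (λ x → (x SP.∈? V) ×-dec ¬? (x SP.∈? ⁅ u ⁆))
... | yes (x , xV , xu) = subst (_< ∣ V ∣) (SP.∣⁅x⁆∣≡1 u) (SP.p⊂q⇒∣p∣<∣q∣ ((⁅x⁆⊆ uV) , x , xV , xu))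
... | no nx = ⊥-elim (ne (SP.⊆-antisym sub (⁅x⁆⊆ uV)))
  where
  sub : V ⊆ ⁅ u ⁆
  sub {x} xV with x SP.∈? ⁅ u ⁆
  ... | yes m = m
  ... | no nm = ⊥-elim (nx (x , xV , nm))

isPartitionBy-extend : (U V : Subset n) (u : Fin n) (ps : Pairs n) → u ∈ V → V ⊆ U → V ≢ ⁅ u ⁆ →
  IsPartitionBy (U ∩ ∁ V) ps → IsPartitionBy U ((V , u) ∷ ps)
isPartitionBy-extend U V u ps uV VU ne (al , ap , cv) =
  ((uV , VU , big-nonSingleton u V uV ne) ∷ blocksWithinU ps al) ,
  (disjointFromV ps al ∷ ap) ,
  cov
  where
  blocksWithinU : ∀ ps → All (λ p → (proj₂ p ∈ proj₁ p) × (proj₁ p ⊆ U ∩ ∁ V) × (2 ≤ ∣ proj₁ p ∣)) ps →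
       All (λ p → (proj₂ p ∈ proj₁ p) × (proj₁ p ⊆ U) × (2 ≤ ∣ proj₁ p ∣)) ps
  blocksWithinU [] [] = []
  blocksWithinU (p ∷ ps) ((m , s , b) ∷ al) = (m , ∩∁-⊆ {U = U} {V = V} s , b) ∷ blocksWithinU ps al
  disjointFromV : ∀ ps → All (λ p → (proj₂ p ∈ proj₁ p) × (proj₁ p ⊆ U ∩ ∁ V) × (2 ≤ ∣ proj₁ p ∣)) ps →
       All (λ q → Disjoint V (proj₁ q)) ps
  disjointFromV [] [] = []
  disjointFromV (p ∷ ps) ((m , s , b) ∷ al) = disjoint-∩∁ {U = U} s ∷ disjointFromV ps al
  cov : ∀ a → a ∈ U → Any (λ p → a ∈ proj₁ p) ((V , u) ∷ ps)
  cov a aU with a SP.∈? V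
  ... | yes aV = here aV
  ... | no naV = there (cv a (SP.x∈p∩q⁺ (aU , SP.x∉p⇒x∈∁p naV)))

suspend-within : ∀ {k} (U V : Subset n) (u : Fin n) (b : Chain n) → u ∈ V → V ⊆ U →
  ChainWithin k (U ∩ ∁ V) b → ChainWithin (suc k) U (negChain (suspend V u b))
suspend-within U V u b uV VU hb =
  negChain-All (suspend V u b) (AllP.++⁺ (join-All V b (All.map addV hb)) (negChain-All (join ⁅ u ⁆ b) (join-All ⁅ u ⁆ b (All.map addPole hb))))
  where
  addV : ∀ {w} → FaceWithin _ (U ∩ ∁ V) w → FaceWithin (suc _) U (V ∷ w)
  disjointFromV : ∀ w → All (_⊆ U ∩ ∁ V) w → All (Disjoint V) w
  disjointFromV [] [] = []
  disjointFromV (x ∷ w) (s ∷ ws) = disjoint-∩∁ {U = U} s ∷ disjointFromV w ws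
  withinU : ∀ w → All (_⊆ U ∩ ∁ V) w → All (_⊆ U) w
  withinU [] [] = []
  withinU (x ∷ w) (s ∷ ws) = ∩∁-⊆ {U = U} {V = V} s ∷ withinU w ws
  disjointFromPole : ∀ w → All (_⊆ U ∩ ∁ V) w → All (Disjoint ⁅ u ⁆) w
  disjointFromPole [] [] = []
  disjointFromPole (x ∷ w) (s ∷ ws) = disjoint-⊆ˡ (disjoint-∩∁ {U = U} s) (⁅x⁆⊆ uV) ∷ disjointFromPole w ws
  addV {w} ((l , ne , ap) , ws) = (cong suc l , ((_ , uV) ∷ ne) , (disjointFromV w ws ∷ ap)) , (VU ∷ withinU w ws)
  addPole : ∀ {w} → FaceWithin _ (U ∩ ∁ V) w → FaceWithin (suc _) U (⁅ u ⁆ ∷ w)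
  addPole {w} ((l , ne , ap) , ws) = (cong suc l , (⁅x⁆-nonempty u ∷ ne) , (disjointFromPole w ws ∷ ap)) ,
                            ((λ x → VU (⁅x⁆⊆ uV x)) ∷ withinU w ws)

filterChain-All : ∀ {Q : Term n → Set} (p : List (Subset n) → Bool) (c : Chain n) → All Q c →
  All (λ t → Q t × p (proj₂ t) ≡ true) (filterChain p c)
filterChain-All p [] [] = []
filterChain-All p ((a , v) ∷ c) (q ∷ qs) with p v in e
... | true = (q , e) ∷ filterChain-All p c qs
... | false = filterChain-All p c qs

cone-within : ∀ {k} (u : Fin n) (U : Subset n) → u ∈ U → (z : Chain n) → ChainWithin k U z → ChainWithin (suc k) U (ConeAt.cone u z)
cone-within {k = k} u U uU z hz = join-All ⁅ u ⁆ (filterChain (avoids u) z) (All.map (λ {t} → addPole {t}) (filterChain-All {Q = λ t → FaceWithin k U (proj₂ t)} (avoids u) z hz))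
  where
  addPole : ∀ {t : Term _} → FaceWithin k U (proj₂ t) × avoids u (proj₂ t) ≡ true → FaceWithin (suc k) U (⁅ u ⁆ ∷ proj₂ t)
  addPole {a , w} (((l , ne , ap) , ws) , t0) =
    (cong suc l , ⁅x⁆-nonempty u ∷ ne , disjointFromPole w (anyᵇ-false⇒All (hasElem u) w (not≡true⇒≡false _ t0)) ∷ ap) , ((λ x → subst (_∈ U) (sym (SP.x∈⁅y⁆⇒x≡y u x)) uU) ∷ ws)
    where
    disjointFromPole : ∀ w → All (λ W → hasElem u W ≡ false) w → All (Disjoint ⁅ u ⁆) w
    disjointFromPole [] [] = []
    disjointFromPole (W ∷ w) (hw ∷ hs) = disjoint-intro (λ xu xW → true≢false (trans (sym (∈⇒hasElem u W (subst (_∈ W) (SP.x∈⁅y⁆⇒x≡y u xu) xW))) hw)) ∷ disjointFromPole w hs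

vertices : Chain n → List (Subset n)
vertices z = concatMap proj₂ z

filterSubsets-All : (g : Subset n → Bool) (l : List (Subset n)) → All (λ V → g V ≡ true) (filterSubsets g l)
filterSubsets-All g [] = []
filterSubsets-All g (x ∷ l) with g x in e
... | true = e ∷ filterSubsets-All g l
... | false = filterSubsets-All g l

filterSubsets-mono : ∀ {Q : Subset n → Set} (g : Subset n → Bool) (l : List (Subset n)) → All Q l → All Q (filterSubsets g l)
filterSubsets-mono g [] [] = []
filterSubsets-mono g (x ∷ l) (q ∷ qs) with g x
... | true = q ∷ filterSubsets-mono g l qs
... | false = filterSubsets-mono g l qs

filterSubsets-Any : (g : Subset n → Bool) (V : Subset n) (l : List (Subset n)) → g V ≡ true → Any (V ≡_) l → Any (V ≡_) (filterSubsets g l)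
filterSubsets-Any g V (x ∷ l) gv (here refl) rewrite gv = here refl
filterSubsets-Any g V (x ∷ l) gv (there a) with g x
... | true = there (filterSubsets-Any g V l gv a)
... | false = filterSubsets-Any g V l gv a

vertices-Any : (z : Chain n) → All (λ t → ∀ V → Any (V ≡_) (proj₂ t) → Any (V ≡_) (vertices z)) z
vertices-Any [] = []
vertices-Any ((a , τ) ∷ z) = (λ V m → AnyP.++⁺ˡ m) ∷ All.map (λ f V m → AnyP.++⁺ʳ τ (f V m)) (vertices-Any z)

vertices-All : ∀ {Q : Subset n → Set} (z : Chain n) → All (λ t → All Q (proj₂ t)) z → All Q (vertices z)
vertices-All [] [] = []
vertices-All ((a , τ) ∷ z) (h ∷ hs) = AllP.++⁺ h (vertices-All z hs)

combPairs-++ : (A B : List (ℤ × Pairs n)) → combPairs (A ++ B) ≡ combPairs A ++ combPairs B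
combPairs-++ [] B = refl
combPairs-++ ((a , ps) ∷ A) B = trans (cong (scale a (crossCycle ps) ++_) (combPairs-++ A B)) (sym (LP.++-assoc (scale a (crossCycle ps)) _ _))

++-interchange-≋ : (A B C D : Chain n) → ((A ++ B) ++ (C ++ D)) ≋ ((A ++ C) ++ (B ++ D))
++-interchange-≋ A B C D = ≋-trans (++-assoc-≋ A B (C ++ D)) (≋-trans (++-congʳ A (++-leftComm-≋ B C D)) (≋-sym (++-assoc-≋ A C (B ++ D))))

Decomposition : ℕ → Subset n → Chain n → Set
Decomposition {n} k U z = Σ (List (ℤ × Pairs n)) λ L → Σ (Chain n) λ b →
   All (λ q → IsPartitionBy U (proj₂ q) × length (proj₂ q) ≡ k) L × ChainWithin (suc k) U b × z ≋ (combPairs L ++ ∂ b)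

Decomposition-≋ : ∀ {k U} {z z′ : Chain n} → z ≋ z′ → Decomposition k U z′ → Decomposition k U z
Decomposition-≋ z≋z′ (L , b , hL , hb , eq) = L , b , hL , hb , ≋-trans z≋z′ eq

Decomposition-++ : ∀ {k U} {z z′ : Chain n} → Decomposition k U z → Decomposition k U z′ → Decomposition k U (z ++ z′)
Decomposition-++ (L , b , hL , hb , eq) (L′ , b′ , hL′ , hb′ , eq′) =
  L ++ L′ , b ++ b′ , AllP.++⁺ hL hL′ , AllP.++⁺ hb hb′ ,
  ≋-trans (++-cong eq eq′) (≋-trans (++-interchange-≋ (combPairs L) (∂ b) (combPairs L′) (∂ b′))
    (≡⇒≋ (sym (cong₂ _++_ (combPairs-++ L L′) (∂-++ b b′)))))

Decomposition-concatMap : ∀ {A : Set} {k U} (f : A → Chain n) (xs : List A) →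
  All (λ x → Decomposition k U (f x)) xs → Decomposition k U (concatMap f xs)
Decomposition-concatMap f [] [] = [] , [] , [] , [] , ≋-refl
Decomposition-concatMap f (x ∷ xs) (d ∷ ds) = Decomposition-++ d (Decomposition-concatMap f xs ds)

Decomposition-∂ : ∀ {k U} {c z : Chain n} → ChainWithin (suc k) U c → Decomposition k U z → Decomposition k U (∂ c ++ z)
Decomposition-∂ {c = c} hc (L , b , hL , hb , eq) =
  L , c ++ b , hL , AllP.++⁺ hc hb ,
  ≋-trans (++-congʳ (∂ c) eq) (≋-trans (++-leftComm-≋ (∂ c) (combPairs L) (∂ b))
    (≡⇒≋ (cong (combPairs L ++_) (sym (∂-++ c b)))))

Decomposition-suspend : ∀ {k} {U V : Subset n} {u : Fin n} {y : Chain n} → u ∈ V → V ⊆ U → V ≢ ⁅ u ⁆ →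
  Decomposition k (U ∩ ∁ V) y → Decomposition (suc k) U (suspend V u y)
Decomposition-suspend {k = k} {U} {V} {u} uV VU V≢u (L , b , hL , hb , eq) =
  extendPairs V u L , negChain (suspend V u b) , extend L hL , suspend-within U V u b uV VU hb ,
  ≋-trans (suspend-cong V u eq)
    (≋-trans (suspend-++ V u (combPairs L) (∂ b)) (++-cong (suspend-combPairs V u L) (suspend-∂ V u b)))
  where
  extend : ∀ L → All (λ q → IsPartitionBy (U ∩ ∁ V) (proj₂ q) × length (proj₂ q) ≡ k) L →
           All (λ q → IsPartitionBy U (proj₂ q) × length (proj₂ q) ≡ suc k) (extendPairs V u L)
  extend [] [] = []
  extend ((c , ps) ∷ L) ((pp , lp) ∷ hs) = (isPartitionBy-extend U V u ps uV VU V≢u pp , cong suc lp) ∷ extend L hs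

faceWithin-0 : (U : Subset n) (w : List (Subset n)) → FaceWithin 0 U w → w ≡ []
faceWithin-0 U [] _ = refl

cycle-decomposes : ∀ k (U : Subset n) (z : Chain n) → ChainWithin k U z → ∂ z ≋ [] → Decomposition k U z
cycle-decomposes zero U z hz cz with SP.nonempty? U
... | yes (u , uU) = [] , join ⁅ u ⁆ z , [] , join-All ⁅ u ⁆ z (All.map f hz) ,
      ≋-sym (≋-trans (∂-join ⁅ u ⁆ z) (++-≋[]ʳ (negChain-cong {d = []} (join-cong ⁅ u ⁆ cz)) z))
  where
  f : ∀ {w} → FaceWithin 0 U w → FaceWithin 1 U (⁅ u ⁆ ∷ w)
  f {w} fi rewrite faceWithin-0 U w fi = (refl , ⁅x⁆-nonempty u ∷ [] , [] ∷ []) , ((λ x → subst (_∈ U) (sym (SP.x∈⁅y⁆⇒x≡y u x)) uU) ∷ [])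
... | no ne = map (λ t → (proj₁ t , [])) z , [] , allL z , [] , ≋-trans (eqz z hz) (≋-sym (++-identityʳ-≋ _))
  where
  pu : IsPartitionBy U []
  pu = [] , [] , (λ a m → ⊥-elim (ne (a , m)))
  allL : ∀ z → All (λ q → IsPartitionBy U (proj₂ q) × length (proj₂ q) ≡ 0) (map (λ t → (proj₁ t , [])) z)
  allL [] = []
  allL (t ∷ z) = (pu , refl) ∷ allL z
  eqz : ∀ z → ChainWithin 0 U z → z ≋ combPairs (map (λ t → (proj₁ t , [])) z)
  eqz [] [] = ≋-refl
  eqz ((a , w) ∷ z) (fi ∷ fs) rewrite faceWithin-0 U w fi =
    ++-cong {c = (a , []) ∷ []} (singleton-≋ a (a * + 1) [] [] (termCoeff-cong a (a * + 1) [] [] refl (cong (+ 1 *_) (sym (ZP.*-identityʳ a))))) (eqz z fs)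
cycle-decomposes (suc k) U z hz cz with SP.nonempty? U
cycle-decomposes (suc k) U [] hz cz | no ne = [] , [] , [] , [] , ≋-refl
cycle-decomposes (suc k) U ((a , (x ∷ w)) ∷ z) (((l , (xn ∷ _) , _) , (xU ∷ _)) ∷ _) cz | no ne = ⊥-elim (ne (proj₁ xn , xU (proj₂ xn)))
cycle-decomposes (suc k) U z hz cz | yes (u , uU) =
  Decomposition-≋ z≋ (Decomposition-∂ (cone-within u U uU z hz)
    (Decomposition-concatMap (λ V → suspend V u (link V z)) Ws (All.zipWith {P = λ V → isLinkVertex V ≡ true} {Q = _⊆ U} (λ (g , VU) → linkDecomposes g VU) (gWs , sWs))))
  where
  open ConeAt u
  Ws = dedup (filterSubsets isLinkVertex (vertices z))
  gWs : LinkVertices Ws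
  gWs = dedup-All _ (filterSubsets-All isLinkVertex (vertices z))
  sWs : All (_⊆ U) Ws
  sWs = dedup-All _ (filterSubsets-mono isLinkVertex _ (vertices-All z (All.map proj₂ hz)))
  fz : All (λ t → IsFace (proj₂ t)) z
  fz = All.map (λ fi → proj₂ (proj₁ fi)) hz
  oncez : AllCountOnce Ws z
  oncez = All.map (λ f V0 g a → dedup-countsOnce V0 (filterSubsets isLinkVertex (vertices z))
                    (filterSubsets-All isLinkVertex (vertices z)) (filterSubsets-Any isLinkVertex V0 (vertices z) g (f V0 a)))
                  (vertices-Any z)
  linkDecomposes : ∀ {V} → isLinkVertex V ≡ true → V ⊆ U → Decomposition (suc k) U (suspend V u (link V z))
  linkDecomposes {V} g VU = Decomposition-suspend (hasElem⇒∈ u V (isLinkVertex⇒∋ V g)) VU (isLinkVertex⇒≢pole V g)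
    (cycle-decomposes k (U ∩ ∁ V) (link V z) (link-within u U V z hz) (∂-link V z fz cz))
  z≋ : z ≋ (∂ (cone z) ++ concatMap (λ V → suspend V u (link V z)) Ws)
  z≋ = ≋-trans (chain-decomposition Ws gWs z fz oncez)
         (++-congʳ (∂ (cone z)) (≋-trans (++-≋[]ˡ (join-cong pole (filterChain-cong (avoids u) (avoids-sortInvariant u) cz)) _)
           (suspendedLinks-exchange Ws z)))

-- Reordering the blocks and changing the chosen points
scale-1 : (c : Chain n) → scale (+ 1) c ≋ c
scale-1 c = ⟨ (λ τ → trans (coeff-scale (+ 1) c τ) (ZP.*-identityˡ _)) ⟩

scale-scale : (a b : ℤ) (c : Chain n) → scale a (scale b c) ≋ scale (a * b) c
scale-scale a b c = ⟨ (λ τ → trans (coeff-scale a (scale b c) τ) (trans (cong (a *_) (coeff-scale b c τ))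
   (trans (sym (ZP.*-assoc a b _)) (sym (coeff-scale (a * b) c τ))))) ⟩

neg-as-scale : (c : Chain n) → negChain c ≋ scale (- + 1) c
neg-as-scale c = ⟨ (λ τ → trans (coeff-neg c τ) (trans (sym (ZP.-1*i≡-i _)) (sym (coeff-scale (- + 1) c τ)))) ⟩

∂term-scale : (k b : ℤ) (v : List (Subset n)) → ∂term (k * b) v ≡ scale k (∂term b v)
∂term-scale k b [] = refl
∂term-scale k b (x ∷ v) = cong ((k * b , v) ∷_)
  (trans (cong (λ c → join x (∂term c v)) (ZP.neg-distribʳ-* k b)) (trans (cong (join x) (∂term-scale k (- b) v)) (sym (sc x (∂term (- b) v)))))
  where
  sc : ∀ x c → scale k (join x c) ≡ join x (scale k c)
  sc x [] = refl
  sc x (t ∷ c) = cong (_ ∷_) (sc x c)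

∂-scale : (k : ℤ) (c : Chain n) → ∂ (scale k c) ≡ scale k (∂ c)
∂-scale k [] = refl
∂-scale k ((b , v) ∷ c) = trans (cong₂ _++_ (∂term-scale k b v) (∂-scale k c)) (sym (LP.map-++ _ (∂term b v) (∂ c)))

coeff-suspend : (B : Subset n) (t : Fin n) (X : Chain n) (τ : List (Subset n)) →
  coeff (suspend B t X) τ ≡ coeff (join B X) τ + - coeff (join ⁅ t ⁆ X) τ
coeff-suspend B t X τ = trans (coeff-++ (join B X) _ τ) (cong (_+_ (coeff (join B X) τ)) (coeff-neg (join ⁅ t ⁆ X) τ))

coeff-join-suspend : (x B : Subset n) (t : Fin n) (X : Chain n) (τ : List (Subset n)) →
  coeff (join x (suspend B t X)) τ ≡ coeff (join x (join B X)) τ + - coeff (join x (join ⁅ t ⁆ X)) τ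
coeff-join-suspend x B t X τ rewrite join-++ x (join B X) (negChain (join ⁅ t ⁆ X)) | join-negChain x (join ⁅ t ⁆ X) =
  trans (coeff-++ (join x (join B X)) _ τ) (cong (_+_ (coeff (join x (join B X)) τ)) (coeff-neg (join x (join ⁅ t ⁆ X)) τ))

coeff-join-swap : (x y : Subset n) → x ≢ y → (X : Chain n) (τ : List (Subset n)) → coeff (join x (join y X)) τ ≡ - coeff (join y (join x X)) τ
coeff-join-swap x y ne X τ = trans (≋⇒≈ (join-swap x y ne X) τ) (coeff-neg (join y (join x X)) τ)

-- Joins with two distinct vertices anticommute, and all four vertices B, {t}, B', {t'} are distinct.
suspend-swap : (B B' : Subset n) (t t' : Fin n) → Disjoint B B' → t ∈ B → t' ∈ B' → (X : Chain n) →
  suspend B t (suspend B' t' X) ≋ negChain (suspend B' t' (suspend B t X))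
suspend-swap B B' t t' d tB tB' X = ⟨ (λ τ →
  trans (coeff-suspend B t (suspend B' t' X) τ)
   (trans (cong₂ (λ p q → p + - q) (coeff-join-suspend B B' t' X τ) (coeff-join-suspend ⁅ t ⁆ B' t' X τ))
    (trans (cong₂ (λ p q → p + - q) (cong₂ (λ p q → p + - q) (coeff-join-swap B B' B≢B' X τ) (coeff-join-swap B ⁅ t' ⁆ B≢t' X τ))
                                    (cong₂ (λ p q → p + - q) (coeff-join-swap ⁅ t ⁆ B' t≢B' X τ) (coeff-join-swap ⁅ t ⁆ ⁅ t' ⁆ t≢t' X τ)))
     (trans (alg (coeff (join B' (join B X)) τ) (coeff (join ⁅ t' ⁆ (join B X)) τ) (coeff (join B' (join ⁅ t ⁆ X)) τ) (coeff (join ⁅ t' ⁆ (join ⁅ t ⁆ X)) τ))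
      (sym (trans (coeff-neg (suspend B' t' (suspend B t X)) τ)
        (cong -_ (trans (coeff-suspend B' t' (suspend B t X) τ)
          (cong₂ (λ p q → p + - q) (coeff-join-suspend B' B t X τ) (coeff-join-suspend ⁅ t' ⁆ B t X τ)))))))))) ⟩
  where
  alg : ∀ a b c e → ((- a) + - (- b)) + - ((- c) + - (- e)) ≡ - ((a + - c) + - (b + - e))
  alg = solve-∀
  B≢B' : B ≢ B'
  B≢B' e = disjoint-elim d tB (subst (t ∈_) e tB)
  B≢t' : B ≢ ⁅ t' ⁆
  B≢t' e = disjoint-elim d (subst (t' ∈_) (sym e) (SP.x∈⁅x⁆ t')) tB'
  t≢B' : ⁅ t ⁆ ≢ B'
  t≢B' e = disjoint-elim d tB (subst (t ∈_) e (SP.x∈⁅x⁆ t))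
  t≢t' : ⁅ t ⁆ ≢ ⁅ t' ⁆
  t≢t' e = disjoint-elim d tB (subst (_∈ B') (sym (SP.x∈⁅y⁆⇒x≡y t' (subst (t ∈_) e (SP.x∈⁅x⁆ t)))) tB')

insertPair : Subset n × Fin n → Pairs n → Pairs n
insertPair p [] = p ∷ []
insertPair p (q ∷ qs) = if ltS (proj₁ q) (proj₁ p) then q ∷ insertPair p qs else p ∷ q ∷ qs

sortPairs : Pairs n → Pairs n
sortPairs [] = []
sortPairs (p ∷ ps) = insertPair p (sortPairs ps)

insertPair-All : ∀ {Q : Subset n × Fin n → Set} (p : Subset n × Fin n) (qs : Pairs n) → Q p → All Q qs → All Q (insertPair p qs)
insertPair-All p [] qp [] = qp ∷ []
insertPair-All p (q ∷ qs) qp (qq ∷ qqs) with ltS (proj₁ q) (proj₁ p)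
... | true = qq ∷ insertPair-All p qs qp qqs
... | false = qp ∷ qq ∷ qqs

sortPairs-All : ∀ {Q : Subset n × Fin n → Set} (ps : Pairs n) → All Q ps → All Q (sortPairs ps)
sortPairs-All [] [] = []
sortPairs-All (p ∷ ps) (q ∷ qs) = insertPair-All p (sortPairs ps) q (sortPairs-All ps qs)

insertPair-Any : ∀ {Q : Subset n × Fin n → Set} (p : Subset n × Fin n) (qs : Pairs n) → Any Q (p ∷ qs) → Any Q (insertPair p qs)
insertPair-Any p [] a = a
insertPair-Any p (q ∷ qs) a with ltS (proj₁ q) (proj₁ p)
insertPair-Any p (q ∷ qs) (here x) | true = there (insertPair-Any p qs (here x))
insertPair-Any p (q ∷ qs) (there (here x)) | true = here x
insertPair-Any p (q ∷ qs) (there (there x)) | true = there (insertPair-Any p qs (there x))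
... | false = a

sortPairs-Any : ∀ {Q : Subset n × Fin n → Set} (ps : Pairs n) → Any Q ps → Any Q (sortPairs ps)
sortPairs-Any (p ∷ ps) (here x) = insertPair-Any p (sortPairs ps) (here x)
sortPairs-Any (p ∷ ps) (there a) = insertPair-Any p (sortPairs ps) (there (sortPairs-Any ps a))

insertPair-AllPairs : ∀ {R : Subset n × Fin n → Subset n × Fin n → Set} → (∀ {a b} → R a b → R b a) →
  (p : Subset n × Fin n) (qs : Pairs n) → All (R p) qs → AllPairs R qs → AllPairs R (insertPair p qs)
insertPair-AllPairs sym p [] [] [] = [] ∷ []
insertPair-AllPairs {R = R} sym p (q ∷ qs) (r ∷ rs) (a ∷ as) with ltS (proj₁ q) (proj₁ p)
... | true = insertPair-All {Q = R q} p qs (sym r) a ∷ insertPair-AllPairs sym p qs rs as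
... | false = (r ∷ rs) ∷ (a ∷ as)

sortPairs-AllPairs : ∀ {R : Subset n × Fin n → Subset n × Fin n → Set} → (∀ {a b} → R a b → R b a) →
  (ps : Pairs n) → AllPairs R ps → AllPairs R (sortPairs ps)
sortPairs-AllPairs sym [] [] = []
sortPairs-AllPairs sym (p ∷ ps) (a ∷ as) = insertPair-AllPairs sym p (sortPairs ps) (sortPairs-All ps a) (sortPairs-AllPairs sym ps as)

LtPair : Subset n × Fin n → Subset n × Fin n → Set
LtPair p q = ltS (proj₁ p) (proj₁ q) ≡ true

insertPair-sorted : (p : Subset n × Fin n) (qs : Pairs n) → All (λ q → proj₁ q ≢ proj₁ p) qs → AllPairs LtPair qs → AllPairs LtPair (insertPair p qs)
insertPair-sorted p [] [] [] = [] ∷ []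
insertPair-sorted p (q ∷ qs) (ne ∷ nes) (a ∷ as) with ltS (proj₁ q) (proj₁ p) in e
... | true = insertPair-All {Q = LtPair q} p qs e a ∷ insertPair-sorted p qs nes as
... | false = (pq ∷ All.map (λ qr → ltS-trans (proj₁ p) (proj₁ q) _ pq qr) a) ∷ (a ∷ as)
  where
  pq : ltS (proj₁ p) (proj₁ q) ≡ true
  pq with ltS-total (proj₁ p) (proj₁ q) (λ x → ne (sym x))
  ... | inj₁ h = h
  ... | inj₂ h with () ← trans (sym h) e

sortPairs-sorted : (ps : Pairs n) → AllPairs (λ p q → proj₁ p ≢ proj₁ q) ps → AllPairs LtPair (sortPairs ps)
sortPairs-sorted [] [] = []
sortPairs-sorted (p ∷ ps) (a ∷ as) = insertPair-sorted p (sortPairs ps) (sortPairs-All ps (All.map (λ ne e → ne (sym e)) a)) (sortPairs-sorted ps as)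

crossCycle-insertPair : (B : Subset n) (t : Fin n) (qs : Pairs n) → t ∈ B →
  All (λ q → Disjoint B (proj₁ q) × proj₂ q ∈ proj₁ q) qs →
  Σ ℤ λ ε → (crossCycle ((B , t) ∷ qs) ≋ scale ε (crossCycle (insertPair (B , t) qs)))
crossCycle-insertPair B t [] tB [] = + 1 , ≋-sym (scale-1 _)
crossCycle-insertPair B t ((B' , t') ∷ qs) tB ((d , tB') ∷ rs) with ltS B' B
... | true with crossCycle-insertPair B t qs tB rs
...   | ε , eq = - + 1 * ε ,
  ≋-trans (suspend-swap B B' t t' d tB tB' (crossCycle qs))
   (≋-trans (negChain-cong (suspend-cong B' t' eq))
    (≋-trans (negChain-cong (suspend-scale B' t' ε (crossCycle (insertPair (B , t) qs))))
     (≋-trans (neg-as-scale _) (scale-scale (- + 1) ε _))))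
crossCycle-insertPair B t ((B' , t') ∷ qs) tB ((d , tB') ∷ rs) | false = + 1 , ≋-sym (scale-1 _)

crossCycle-sortPairs : (ps : Pairs n) → All (λ q → proj₂ q ∈ proj₁ q) ps → AllPairs (λ p q → Disjoint (proj₁ p) (proj₁ q)) ps →
  Σ ℤ λ ε → (crossCycle ps ≋ scale ε (crossCycle (sortPairs ps)))
crossCycle-sortPairs [] [] [] = + 1 , ≋-sym (scale-1 _)
crossCycle-sortPairs ((B , t) ∷ ps) (tB ∷ ms) (d ∷ ds) with crossCycle-sortPairs ps ms ds
... | ε1 , eq1 with crossCycle-insertPair B t (sortPairs ps) tB (sortPairs-All ps (All.zip (d , ms)))
...   | ε2 , eq2 = ε1 * ε2 ,
  ≋-trans (suspend-cong B t eq1) (≋-trans (suspend-scale B t ε1 (crossCycle (sortPairs ps)))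
    (≋-trans (scale-cong ε1 eq2) (scale-scale ε1 ε2 _)))

VerticesIn : List (Subset n) → Chain n → Set
VerticesIn bl c = All (λ t → All (λ V → Any (V ⊆_) bl) (proj₂ t)) c

disjoint-in : {B V : Subset n} (bl : List (Subset n)) → All (Disjoint B) bl → Any (V ⊆_) bl → Disjoint B V
disjoint-in (p ∷ ps) (d ∷ ds) (here s) = disjoint-⊆ʳ d s
disjoint-in (p ∷ ps) (d ∷ ds) (there a) = disjoint-in ps ds a

join-verticesIn : ∀ {k} (bl : List (Subset n)) (x B : Subset n) (c : Chain n) → Nonempty x → x ⊆ B → All (Disjoint B) bl →
  IsChainOf k c → VerticesIn bl c → IsChainOf (suc k) (join x c) × VerticesIn (B ∷ bl) (join x c)
join-verticesIn bl x B c ne xB d hc vc =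
  join-isChainOf x c ne (All.map (All.map (λ a → disjoint-⊆ˡ (disjoint-in bl d a) xB)) vc) hc ,
  join-All x c (All.map (λ h → here xB ∷ All.map there h) vc)

suspend-verticesIn : ∀ {k} (bl : List (Subset n)) (B : Subset n) (t : Fin n) (c : Chain n) → t ∈ B → All (Disjoint B) bl →
  IsChainOf k c → VerticesIn bl c → IsChainOf (suc k) (suspend B t c) × VerticesIn (B ∷ bl) (suspend B t c)
suspend-verticesIn bl B t c tB d hc vc =
  AllP.++⁺ (proj₁ r1) (negChain-isChainOf _ (proj₁ r2)) , AllP.++⁺ (proj₂ r1) (negChain-All (join ⁅ t ⁆ c) (proj₂ r2))
  where
  r1 = join-verticesIn bl B B c (t , tB) (λ z → z) d hc vc
  r2 = join-verticesIn bl ⁅ t ⁆ B c (⁅x⁆-nonempty t) (⁅x⁆⊆ tB) d hc vc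

crossCycle-verticesIn : (ps : Pairs n) → All (λ p → proj₂ p ∈ proj₁ p) ps → VerticesIn (map proj₁ ps) (crossCycle ps)
crossCycle-verticesIn ps ms = All.map (All.map (AnyP.map⁺)) (crossCycle-verticesWithin ps ms)

suspend-changePole : ∀ {k} (bl : List (Subset n)) (B : Subset n) (t t′ : Fin n) (X : Chain n) →
  t ∈ B → t′ ∈ B → All (Disjoint B) bl → IsChainOf k X → VerticesIn bl X → ∂ X ≋ [] →
  Σ (Chain n) λ d → IsChainOf (suc (suc k)) d × VerticesIn (B ∷ bl) d × (suspend B t X ≋ (suspend B t′ X ++ ∂ d))
suspend-changePole bl B t t′ X tB t′B d hX vX cX with t FP.≟ t′
... | yes refl = [] , [] , [] , ≋-sym (++-identityʳ-≋ _)
... | no t≢t′ = join ⁅ t ⁆ (join ⁅ t′ ⁆ X) , isChain , inBlocks , ≋-sym (≋-trans (++-congʳ (suspend B t′ X) ∂d) cancel)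
  where
  t′X = join ⁅ t′ ⁆ X
  disjoint-tt′ : Disjoint ⁅ t ⁆ ⁅ t′ ⁆
  disjoint-tt′ = disjoint-intro (λ a b → t≢t′ (trans (sym (SP.x∈⁅y⁆⇒x≡y t a)) (SP.x∈⁅y⁆⇒x≡y t′ b)))
  isChain : IsChainOf (suc (suc _)) (join ⁅ t ⁆ t′X)
  isChain = join-isChainOf ⁅ t ⁆ t′X (⁅x⁆-nonempty t)
    (join-All ⁅ t′ ⁆ X (All.map (λ h → disjoint-tt′ ∷ All.map (λ a → disjoint-⊆ˡ (disjoint-in bl d a) (⁅x⁆⊆ tB)) h) vX))
    (proj₁ (join-verticesIn bl ⁅ t′ ⁆ B X (⁅x⁆-nonempty t′) (⁅x⁆⊆ t′B) d hX vX))
  inBlocks : VerticesIn (B ∷ bl) (join ⁅ t ⁆ t′X)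
  inBlocks = join-All ⁅ t ⁆ _ (join-All ⁅ t′ ⁆ X (All.map (λ h → here (⁅x⁆⊆ tB) ∷ here (⁅x⁆⊆ t′B) ∷ All.map there h) vX))
  ∂d : ∂ (join ⁅ t ⁆ t′X) ≋ (t′X ++ negChain (join ⁅ t ⁆ X))
  ∂d = ≋-trans (∂-join ⁅ t ⁆ t′X)
    (++-congʳ t′X (negChain-cong (join-cong ⁅ t ⁆ (≋-trans (∂-join ⁅ t′ ⁆ X)
       (++-≋[]ʳ (negChain-cong {d = []} (join-cong ⁅ t′ ⁆ cX)) X)))))
  cancel : (suspend B t′ X ++ (t′X ++ negChain (join ⁅ t ⁆ X))) ≋ suspend B t X
  cancel = ≋-trans (++-assoc-≋ (join B X) (negChain t′X) _)
    (++-congʳ (join B X) (≋-trans (≋-sym (++-assoc-≋ (negChain t′X) t′X _))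
      (++-≋[]ˡ (≋-trans (++-comm-≋ (negChain t′X) _) (++-negChain-≋[] t′X)) _)))

crossCycle-changePoints : (ps qs : Pairs n) → map proj₁ ps ≡ map proj₁ qs →
  All (λ p → proj₂ p ∈ proj₁ p) ps → All (λ p → proj₂ p ∈ proj₁ p) qs → AllPairs Disjoint (map proj₁ ps) →
  Σ (Chain n) λ c → IsChainOf (suc (length ps)) c × VerticesIn (map proj₁ ps) c × (crossCycle ps ≋ (crossCycle qs ++ ∂ c))
crossCycle-changePoints [] [] e [] [] [] = [] , [] , [] , ≋-sym (++-identityʳ-≋ _)
crossCycle-changePoints ((B , t) ∷ ps) ((B′ , t′) ∷ qs) e (tB ∷ ms) (t′B ∷ ms′) (d ∷ ds) with LP.∷-injective e
... | refl , e′ with crossCycle-changePoints ps qs e′ ms ms′ ds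
...   | c′ , hc′ , vc′ , eq′ =
  dd ++ negChain (suspend B t c′) , AllP.++⁺ hdd (negChain-isChainOf _ (proj₁ sc)) ,
  AllP.++⁺ vdd (negChain-All (suspend B t c′) (proj₂ sc)) ,
  ≋-trans (suspend-cong B t eq′)
    (≋-trans (suspend-++ B t X (∂ c′))
     (≋-trans (++-cong eqdd (suspend-∂ B t c′))
      (≋-trans (++-assoc-≋ (suspend B t′ X) (∂ dd) _)
        (≡⇒≋ (cong (suspend B t′ X ++_) (sym (∂-++ dd (negChain (suspend B t c′)))))))))
  where
  X = crossCycle qs
  bl = map proj₁ ps
  lenq : length qs ≡ length ps
  lenq = trans (sym (LP.length-map proj₁ qs)) (trans (cong length (sym e′)) (LP.length-map proj₁ ps))
  hX : IsChainOf (length ps) X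
  hX = subst (λ k → IsChainOf k X) lenq (crossCycle-isChainOf qs (ms′ , AllPairsP.map⁻ (subst (AllPairs Disjoint) e′ ds)))
  vX : VerticesIn bl X
  vX = subst (λ l → VerticesIn l X) (sym e′) (crossCycle-verticesIn qs ms′)
  sc = suspend-verticesIn bl B t c′ tB d hc′ vc′
  poleChange = suspend-changePole bl B t t′ X tB t′B d hX vX (∂-crossCycle qs)
  dd = proj₁ poleChange
  hdd = proj₁ (proj₂ poleChange)
  vdd = proj₁ (proj₂ (proj₂ poleChange))
  eqdd = proj₂ (proj₂ (proj₂ poleChange))

insertPair-length : (p : Subset n × Fin n) (qs : Pairs n) → length (insertPair p qs) ≡ suc (length qs)
insertPair-length p [] = refl
insertPair-length p (q ∷ qs) with ltS (proj₁ q) (proj₁ p)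
... | true = cong suc (insertPair-length p qs)
... | false = refl

sortPairs-length : (ps : Pairs n) → length (sortPairs ps) ≡ length ps
sortPairs-length [] = refl
sortPairs-length (p ∷ ps) = trans (insertPair-length p (sortPairs ps)) (cong suc (sortPairs-length ps))

partitionOfPairs : ∀ {j} (ps : Pairs n) → IsPartitionBy ⊤ ps → length ps ≡ j →
  Σ (NSPart n j) λ F → toList (blocks F) ≡ map proj₁ (sortPairs ps)
partitionOfPairs {j = j} ps (al , ap , cv) lj = F , tx
  where
  ps′ = sortPairs ps
  mv = vecOfList (map proj₁ ps′) j (trans (LP.length-map proj₁ ps′) (trans (sortPairs-length ps) lj))
  x = proj₁ mv
  tx : toList x ≡ map proj₁ ps′
  tx = proj₂ mv
  ms : All (λ p → proj₂ p ∈ proj₁ p) ps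
  ms = All.map proj₁ al
  distinct : AllPairs (λ p q → proj₁ p ≢ proj₁ q) ps
  distinct = AllPairs.map (λ (tB , d) e → disjoint-elim d tB (subst (_ ∈_) e tB)) (AllPairs-withAll ps ms ap)
  F : NSPart _ j
  F = record
    { blocks = x
    ; sorted = subst (Linked (λ p q → T (ltS p q))) (sym tx)
                 (LkP.AllPairs⇒Linked (AllPairsP.map⁺ (AllPairs.map (λ e → subst T (sym e) tt) (sortPairs-sorted ps distinct))))
    ; disjoint = subst (AllPairs Disjoint) (sym tx) (AllPairsP.map⁺ (sortPairs-AllPairs disjoint-sym ps ap))
    ; covers = λ a → subst (Any (a ∈_)) (sym tx) (AnyP.map⁺ (sortPairs-Any ps (cv a SP.∈⊤)))
    ; big = All-lookup x (subst (All (λ B → 2 ≤ ∣ B ∣)) (sym tx) (AllP.map⁺ (All.map (λ h → proj₂ (proj₂ h)) (sortPairs-All ps al))))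
    }

-- Cycles are homologous to combinations of the σ_F
module _ {n j : ℕ} (s : Vec (Subset n) j → Fin j → Fin n)
         (hs : ∀ (F : NSPart n j) (i : Fin j) → s (blocks F) i ∈ lookup (blocks F) i) where

  crossCycle-homologous-sigma : (ps : Pairs n) → IsPartitionBy ⊤ ps → length ps ≡ j →
    Σ (NSPart n j) λ F → Σ ℤ λ ε → Σ (Chain n) λ c → IsChainOf (suc j) c × (crossCycle ps ≋ (scale ε (σ s F) ++ ∂ c))
  crossCycle-homologous-sigma ps pp@(al , ap , _) lj = F , ε , scale ε c , scale-All ε c hc , eq
    where
    sorting = crossCycle-sortPairs ps (All.map proj₁ al) ap
    ε = proj₁ sorting
    ps′ = sortPairs ps
    F = proj₁ (partitionOfPairs ps pp lj)
    x = blocks F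
    qs = blockPairs x (s x)
    changing = crossCycle-changePoints ps′ qs (trans (sym (proj₂ (partitionOfPairs ps pp lj))) (sym (blockPairs-blocks x (s x))))
      (All.map proj₁ (sortPairs-All ps al)) (blockPairs-∈ x (s x) (hs F)) (AllPairsP.map⁺ (sortPairs-AllPairs disjoint-sym ps ap))
    c = proj₁ changing
    hc : IsChainOf (suc j) c
    hc = subst (λ k → IsChainOf (suc k) c) (trans (sortPairs-length ps) lj) (proj₁ (proj₂ changing))
    eq : crossCycle ps ≋ (scale ε (σ s F) ++ ∂ (scale ε c))
    eq = ≋-trans (proj₂ sorting) (≋-trans (scale-cong ε (proj₂ (proj₂ (proj₂ changing))))
           (≡⇒≋ (trans (LP.map-++ _ (crossCycle qs) (∂ c))
                  (cong₂ _++_ (cong (scale ε) (sym (sigma≡crossCycle x (s x)))) (sym (∂-scale ε c))))))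

  combPairs-homologous-comb : (L : List (ℤ × Pairs n)) → All (λ q → IsPartitionBy ⊤ (proj₂ q) × length (proj₂ q) ≡ j) L →
    Σ (List (ℤ × NSPart n j)) λ L' → Σ (Chain n) λ e → IsChainOf (suc j) e × (combPairs L ≋ (comb s L' ++ ∂ e))
  combPairs-homologous-comb [] [] = [] , [] , [] , ≋-refl
  combPairs-homologous-comb ((a , ps) ∷ L) ((pu , lp) ∷ hL) with crossCycle-homologous-sigma ps pu lp | combPairs-homologous-comb L hL
  ... | F , ε , c , hc , eqc | L' , e , he , eqL =
    (a * ε , F) ∷ L' , scale a c ++ e , AllP.++⁺ (scale-All a c hc) he ,
    ≋-trans (++-cong (≋-trans (scale-cong a eqc)
                       (≡⇒≋ (trans (LP.map-++ _ (scale ε (σ s F)) (∂ c)) (cong (scale a (scale ε (σ s F)) ++_) (sym (∂-scale a c))))))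
                     eqL)
     (≋-trans (++-congˡ _ (++-congˡ _ (scale-scale a ε (σ s F))))
      (≋-trans (++-interchange-≋ (scale (a * ε) (σ s F)) (∂ (scale a c)) (comb s L') (∂ e))
        (≡⇒≋ (cong (comb s ((a * ε , F) ∷ L') ++_) (sym (∂-++ (scale a c) e))))))

  cycle-homologous-comb : ∀ (z : Chain n) → IsChainOf j z → ∂ z ≈ [] →
        Σ (List (ℤ × NSPart n j)) λ L → Σ (Chain n) λ b →
          IsChainOf (suc j) b × z ≈ (comb s L ++ ∂ b)
  cycle-homologous-comb z hz cz with cycle-decomposes j ⊤ z (All.map (λ {t} h → h , allTop (proj₂ t)) hz) ⟨ cz ⟩
    where
    allTop : ∀ (w : List (Subset n)) → All (_⊆ ⊤) w
    allTop [] = []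
    allTop (W ∷ w) = SP.⊆⊤ ∷ allTop w
  ... | L , b , hL , hb , eq with combPairs-homologous-comb L hL
  ...   | L' , e , he , eqL = L' , e ++ b , AllP.++⁺ he (All.map proj₁ hb) ,
    ≋⇒≈ (≋-trans eq (≋-trans (++-congˡ (∂ b) eqL)
      (≋-trans (++-assoc-≋ (comb s L') (∂ e) (∂ b)) (≡⇒≋ (cong (comb s L' ++_) (sym (∂-++ e b)))))))

theorem3p5 : ∀ (n j : ℕ) → 1 ≤ j → j ≤ n →
  (s : Vec (Subset n) j → Fin j → Fin n) →
  (∀ (F : NSPart n j) (i : Fin j) → s (blocks F) i ∈ lookup (blocks F) i) →
  (∀ (F : NSPart n j) →
      IsChainOf j (sigma (blocks F) (s (blocks F)))
    × ∂ (sigma (blocks F) (s (blocks F))) ≈ []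
    × CrossPolytope (blocks F) (s (blocks F)))
  × (∀ (z : Chain n) → IsChainOf j z → ∂ z ≈ [] →
      Σ (List (ℤ × NSPart n j)) λ L → Σ (Chain n) λ b →
        IsChainOf (suc j) b × z ≈ (comb s L ++ ∂ b))
  × (∀ (L : List (ℤ × NSPart n j)) →
      AllPairs (λ p q → blocks (proj₂ p) ≢ blocks (proj₂ q)) L →
      ∀ (b : Chain n) → IsChainOf (suc j) b → comb s L ≈ ∂ b →
      All (λ p → proj₁ p ≡ + 0) L)
theorem3p5 n j _ _ s hs = (λ F → sigma-isCrossPolytopeCycle F (s (blocks F)) (hs F)) , cycle-homologous-comb s hs , comb-independent s
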